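{- Let $\mathbb{K}$ be a field containing $\mathbb{Q}$, let $n\ge1$ be an integer and $\mathbf{x}=\{x_1,\dots,x_n\}$ noncommuting variables, with $\mathcal{N}$, $m_w$, $\mathbf{m}_\mu$ and $\Lambda$ as in the context. Let $\mathcal{C}$ be the subalgebra of $\mathcal{N}$ generated by $\{m_v: v\text{ a bimodal word}\}$. Then $\mathcal{C}$ has a basis indexed by the restricted growth words $w$ (with letters in $\{1,\dots,n\}$) whose bimodal decomposition is tail-free, namely the products $m_{w'}m_{w''}\cdots m_{w^{(r)}}$ where $w=w'|w''|\cdots|w^{(r)}$ is the bimodal decomposition. Moreover, the linear map $\varphi:\mathcal{C}\otimes\Lambda\to\mathcal{N}$ defined by $$m_{w'}m_{w''}\cdots m_{w^{(r)}}\otimes\mathbf{m}_\mu\;\longmapsto\; m_{w'w''\cdots w^{(r)}\,\mathsf{w}(\mu)}$$ (concatenation of words) is a vector space isomorphism.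
   Context: Degree-$d$ monomials are functions $\mathbf{z}:[d]\to\mathbf{x}$; the type $\tau(\mathbf{z})$ is the set partition of $[d]$ into nonempty fibers of $\mathbf{z}$; $m_{\mathbf{A}}=\sum_{\tau(\mathbf{z})=\mathbf{A}}\mathbf{z}$ ($=0$ if $\mathbf{A}$ has more than $n$ blocks), $m_\emptyset=1$; $\mathcal{N}=\mathrm{span}\{m_{\mathbf{A}}\}\subseteq\mathbb{K}\langle\mathbf{x}\rangle$ is the algebra of $\mathfrak{S}_n$-invariants under permuting variables. For $\mathbf{A}=\{A_1,\dots,A_r\}$ with blocks ordered by increasing minima, its restricted growth word is $\mathsf{w}(\mathbf{A})=w_1\cdots w_d$ with $w_i=k$ iff $i\in A_k$; this is a bijection onto restricted growth words, i.e. words $w_1\cdots w_d$ over positive integers with $w_1=1$ and $w_i\le1+\max(w_1,\dots,w_{i-1})$. Write $m_w=m_{\mathbf{A}}$ when $w=\mathsf{w}(\mathbf{A})$. Shape $\lambda(\mathbf{A})$ = partition of block sizes; for a partition $\mu=1^{a_1}2^{a_2}\cdots$ of $d$ with $\mathcal{N}_\mu=\mathrm{span}\{m_{\mathbf{A}}:\lambda(\mathbf{A})=\mu\}\neq0$, $\mathbf{m}_\mu=\frac{1}{(\dim\mathcal{N}_\mu)a_1!a_2!\cdots}\sum_{\lambda(\mathbf{A})=\mu}m_{\mathbf{A}}$, and $\Lambda=\mathrm{span}\{\mathbf{m}_\mu\}$ (the partitions $\mu$ with at most $n$ parts, including the empty one, with $\mathbf{m}_\emptyset=1$). For $\mu=(\mu_1\ge\cdots\ge\mu_k>0)$,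 $\mathsf{w}(\mu)=1^{\mu_1}2^{\mu_2}\cdots k^{\mu_k}$; words of this form (including the empty word) are called convex. A restricted growth word $w_1\cdots w_d$ is primary if for no $i>1$ is $w_i\cdots w_d$ a restricted growth word. Every restricted growth word factors uniquely as a concatenation of primary words (its maximal splitting). The bimodal decomposition $w=w'|\cdots|w^{(r)}|w^{(r+1)}$ of $w$ is obtained from its maximal splitting $p_1|p_2|\cdots|p_k$ by scanning left to right and accumulating consecutive primary factors as long as the accumulated concatenation is convex; as soon as appending the next primary factor makes the accumulated word non-convex, that accumulated word (including this factor) is closed off as a bimodal factor and accumulation restarts; the final accumulated (convex, possibly empty) word $w^{(r+1)}$ is the tail. A bimodal word is a restricted growth word $p_1\cdots p_j$ ($p_i$ primary, $j\ge1$) with $p_1\cdots p_{j-1}$ convex (possibly empty) and $p_1\cdots p_j$ not convex, i.e. a word whose bimodal decomposition is itself with empty tail. The decomposition is tail-free if $w^{(r+1)}$ is empty. -}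

module Defs where

open import Level using (Level; _⊔_) renaming (suc to lsuc)
open import Algebra.Bundles using (CommutativeRing)
open import Data.Bool using (Bool; true; false; _∧_; not; if_then_else_)
open import Data.Nat using (ℕ; zero; suc; _≤ᵇ_; _≡ᵇ_; _≤_) renaming (_⊔_ to _⊔ⁿ_)
import Data.Nat as Nat
open import Data.Fin using (Fin)
import Data.Fin as Fin
open import Data.List using (List; []; _∷_; _++_; [_]; map; concat; concatMap; foldr;
  filterᵇ; allFin; length; applyUpTo; replicate; zip; null)
open import Data.Bool.ListAction using (all; any)
open import Data.Nat.ListAction using (sum)
import Data.List.Properties as LP
open import Data.Product using (Σ; _×_; _,_; proj₁; proj₂; ∃)
open import Data.List.Relation.Unary.All using (All)
open import Data.List.Relation.Unary.Unique.Propositional using (Unique)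
open import Relation.Binary.PropositionalEquality using (_≡_)
open import Relation.Nullary using (¬_; does)

record Field (c ℓ : Level) : Set (lsuc (c ⊔ ℓ)) where
  field
    commRing : CommutativeRing c ℓ
  open CommutativeRing commRing public
  field
    1≉0     : ¬ (1# ≈ 0#)
    inverse : ∀ x → ¬ (x ≈ 0#) → Σ Carrier λ y → (x * y) ≈ 1#

module _ {c ℓ} (F : Field c ℓ) where
  open Field F
  ι : ℕ → Carrier
  ι zero    = 0#
  ι (suc k) = 1# + ι k

-- a field contains ℚ iff it has characteristic zero
CharZero : ∀ {c ℓ} → Field c ℓ → Set ℓ
CharZero F = ∀ k → ¬ (Field._≈_ F (ι F (suc k)) (Field.0# F))

-- Words over positive integers (letters are ℕ, the paper's letters 1,2,...)

Word : Set
Word = List ℕ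

_==_ : Word → Word → Bool
u == v = does (LP.≡-dec Nat._≟_ u v)

-- restricted growth words: w₁ = 1 and wᵢ ≤ 1 + max(w₁..wᵢ₋₁); the empty word is one
isRGfrom : ℕ → Word → Bool
isRGfrom m []       = true
isRGfrom m (x ∷ xs) = (1 ≤ᵇ x) ∧ (x ≤ᵇ suc m) ∧ isRGfrom (m ⊔ⁿ x) xs

isRG : Word → Bool
isRG = isRGfrom 0

maxLetter : Word → ℕ
maxLetter = foldr _⊔ⁿ_ 0

nonincr : List ℕ → Bool
nonincr []           = true
nonincr (x ∷ [])     = true
nonincr (x ∷ y ∷ xs) = (y ≤ᵇ x) ∧ nonincr (y ∷ xs)

isPartition : List ℕ → Bool
isPartition μ = all (1 ≤ᵇ_) μ ∧ nonincr μ

-- w(μ) = 1^{μ₁} 2^{μ₂} ⋯ k^{μₖ}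
wordOfFrom : ℕ → List ℕ → Word
wordOfFrom i []       = []
wordOfFrom i (m ∷ μ)  = replicate m (suc i) ++ wordOfFrom (suc i) μ

wordOf : List ℕ → Word
wordOf = wordOfFrom 0

listsOf : ℕ → ℕ → List (List ℕ)
listsOf d zero    = [ [] ]
listsOf d (suc k) = concatMap (λ l → map (_∷ l) (applyUpTo suc d)) (listsOf d k)

partitionsOf : ℕ → List (List ℕ)
partitionsOf d =
  filterᵇ (λ μ → isPartition μ ∧ (sum μ ≡ᵇ d))
          (concatMap (listsOf d) (applyUpTo (λ k → k) (suc d)))

-- convex words: w = w(μ) for some partition μ (necessarily a partition of |w|)
isConvex : Word → Bool
isConvex w = any (λ μ → wordOf μ == w) (partitionsOf (length w))

-- maximal splitting into primary words: cut before every position i > 1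
-- at which the suffix wᵢ⋯w_d is a restricted growth word
splitFrom : Word → Word → List Word
splitFrom acc []       = if null acc then [] else [ acc ]
splitFrom acc (x ∷ xs) =
  if not (null acc) ∧ isRG (x ∷ xs)
  then acc ∷ splitFrom [ x ] xs
  else splitFrom (acc ++ [ x ]) xs

maximalSplitting : Word → List Word
maximalSplitting = splitFrom []

-- bimodal decomposition: (list of bimodal factors w′,…,w⁽ʳ⁾ , tail w⁽ʳ⁺¹⁾)
bimodalFrom : Word → List Word → List Word × Word
bimodalFrom acc []       = ([] , acc)
bimodalFrom acc (p ∷ ps) with isConvex (acc ++ p)
... | true  = bimodalFrom (acc ++ p) ps
... | false = let r = bimodalFrom [] ps in ((acc ++ p) ∷ proj₁ r , proj₂ r)

bimodalDecomposition : Word → List Word × Word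
bimodalDecomposition w = bimodalFrom [] (maximalSplitting w)

bimodalFactors : Word → List Word
bimodalFactors w = proj₁ (bimodalDecomposition w)

IsRG : Word → Set
IsRG w = isRG w ≡ true

IsBimodal : Word → Set
IsBimodal v = IsRG v × bimodalDecomposition v ≡ ([ v ] , [])

IsTailFree : Word → Set
IsTailFree w = proj₂ (bimodalDecomposition w) ≡ []

-- The free algebra 𝕂⟨x₁,…,xₙ⟩, elements = formal finite sums of
-- (coefficient, monomial), equality = equality of all coefficients.

module FreeAlgebra {c ℓ} (F : Field c ℓ) (n : ℕ) where
  open Field F

  Monomial : Set
  Monomial = List (Fin n)

  _=ᴹ_ : Monomial → Monomial → Bool
  u =ᴹ v = does (LP.≡-dec Fin._≟_ u v)

  Poly : Set c
  Poly = List (Carrier × Monomial)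

  coeff : Poly → Monomial → Carrier
  coeff []            u = 0#
  coeff ((a , v) ∷ p) u = if v =ᴹ u then a + coeff p u else coeff p u

  _≈ᴾ_ : Poly → Poly → Set ℓ
  p ≈ᴾ q = ∀ u → coeff p u ≈ coeff q u

  0ᴾ 1ᴾ : Poly
  0ᴾ = []
  1ᴾ = [ (1# , []) ]

  _+ᴾ_ : Poly → Poly → Poly
  _+ᴾ_ = _++_

  _·ᴾ_ : Carrier → Poly → Poly
  a ·ᴾ p = map (λ t → (a * proj₁ t , proj₂ t)) p

  _*ᴾ_ : Poly → Poly → Poly
  p *ᴾ q = concatMap (λ s → map (λ t → (proj₁ s * proj₁ t , proj₂ s ++ proj₂ t)) q) p

  productᴾ : List Poly → Poly
  productᴾ = foldr _*ᴾ_ 1ᴾ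

  monomials : ℕ → List Monomial
  monomials zero    = [ [] ]
  monomials (suc d) = concatMap (λ u → map (_∷ u) (allFin n)) (monomials d)

  -- τ(z) = A, where w = 𝗐(A): zᵢ = zⱼ ⇔ wᵢ = wⱼ for all i, j
  sameType : Monomial → Word → Bool
  sameType z w =
    all (λ s → all (λ t → eqB (does (proj₁ s Fin.≟ proj₁ t)) (proj₂ s ≡ᵇ proj₂ t)) zw) zw
    where
    zw = zip z w
    eqB : Bool → Bool → Bool
    eqB true  b = b
    eqB false b = not b

  m : Word → Poly
  m w = map (λ z → (1# , z)) (filterᵇ (λ z → sameType z w) (monomials (length w)))

  linComb : {I : Set} → (I → Poly) → List (Carrier × I) → Poly
  linComb b ts = concatMap (λ t → proj₁ t ·ᴾ b (proj₂ t)) ts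

  InSpan : {I : Set} → (I → Set) → (I → Poly) → Poly → Set (c ⊔ ℓ)
  InSpan {I} P b x = Σ (List (Carrier × I)) λ ts → All (λ t → P (proj₂ t)) ts × (linComb b ts ≈ᴾ x)

  LinIndep : {I : Set} → (I → Set) → (I → Poly) → Set (c ⊔ ℓ)
  LinIndep {I} P b = ∀ (ts : List (Carrier × I)) → Unique (map proj₂ ts) →
    All (λ t → P (proj₂ t)) ts → linComb b ts ≈ᴾ 0ᴾ → All (λ t → proj₁ t ≈ 0#) ts

  IsBasisOf : {I : Set} → (Poly → Set (c ⊔ ℓ)) → (I → Set) → (I → Poly) → Set (c ⊔ ℓ)
  IsBasisOf S P b = (∀ i → P i → S (b i)) × LinIndep P b × (∀ x → S x → InSpan P b x)

  InN : Poly → Set (c ⊔ ℓ)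
  InN = InSpan IsRG m

  -- 𝒞 = subalgebra generated by { m_v : v bimodal } = span of finite products
  InC : Poly → Set (c ⊔ ℓ)
  InC = InSpan (All IsBimodal) (λ vs → productᴾ (map m vs))

  CIndex : Word → Set
  CIndex w = IsRG w × maxLetter w ≤ n × IsTailFree w

  cBasis : Word → Poly
  cBasis w = productᴾ (map m (bimodalFactors w))

  -- partitions μ with at most n parts (including the empty one) index the basis 𝐦_μ of Λ
  LIndex : List ℕ → Set
  LIndex μ = isPartition μ ≡ true × length μ ≤ n

  -- φ( m_{w′}⋯m_{w⁽ʳ⁾} ⊗ 𝐦_μ ) = m_{w′ w″ ⋯ w⁽ʳ⁾ 𝗐(μ)}
  φBasis : Word × List ℕ → Poly
  φBasis (w , μ) = m (concat (bimodalFactors w) ++ wordOf μ)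

{-# OPTIONS --safe #-}
module Submission where

-- Spanning: the bimodal decomposition of a concatenation of bimodal words v₁, …, v_k is
-- (v₁, …, v_k) with empty tail, so m_{v₁} ⋯ m_{v_k} is either 0 (some vᵢ has more than n blocks)
-- or the basis element of the tail-free word v₁ ⋯ v_k; likewise every m_v equals m_{w 𝗐(μ)},
-- where w is the tail-free part of v and 𝗐(μ) its convex tail.
-- Independence: the coefficient of m_{f₁} ⋯ m_{f_k} at a monomial z is 1 if z cuts into pieces
-- of types f₁, …, f_k and 0 otherwise. A restricted growth word is the lexicographically least
-- word with its kernel, so this coefficient vanishes at the monomial x_{u₁} ⋯ x_{u_d} unless
-- f₁ ⋯ f_k ≤ u, and it is 1 for u = f₁ ⋯ f_k: both families are unitriangular. Distinct indices
-- (w , μ) give distinct words w 𝗐(μ), because the bimodal decomposition recovers w and 𝗐(μ).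
-- The characteristic of 𝕂 plays no role, as all coefficients that occur are 0 or 1.

open import Defs

open import Data.Bool using (Bool; true; false; _∧_; not; if_then_else_; T)
open import Data.Bool.Properties using (T-≡; T-∧; ∧-zeroʳ)
open import Data.Bool.ListAction using (all; any)
open import Data.Empty using (⊥; ⊥-elim)
open import Data.Fin using (Fin)
import Data.Fin as Fin
import Data.Fin.Properties as Fin
open import Data.List using (List; []; _∷_; _++_; [_]; map; concat; concatMap; length;
  replicate; null; applyUpTo; filterᵇ; take; drop; allFin; zip)
import Data.List.Properties as List
open import Data.List.Membership.Propositional using (_∈_; find; lose)
open import Data.List.Membership.Propositional.Properties using (∈-filter⁺; ∈-filter⁻;
  ∈-concatMap⁺; ∈-map⁺; ∈-map⁻; ∈-applyUpTo⁺; ∈-∃++)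
open import Data.List.Relation.Binary.Lex.Core using (base; halt; this; next)
open import Data.List.Relation.Binary.Lex.Strict using (Lex-≤)
import Data.List.Relation.Binary.Lex.Strict as Lex
open import Data.List.Relation.Binary.Pointwise using (Pointwise-≡⇒≡)
open import Data.List.Relation.Unary.All using (All; []; _∷_)
import Data.List.Relation.Unary.All as All
import Data.List.Relation.Unary.All.Properties as All
open import Data.List.Relation.Unary.AllPairs using ([]; _∷_)
open import Data.List.Relation.Unary.Any using (Any; here; there)
import Data.List.Relation.Unary.Any.Properties as Any
open import Data.List.Relation.Unary.Linked using (Linked; []; [-]; _∷_)
open import Data.List.Relation.Unary.Unique.Propositional using (Unique)
open import Data.Nat using (ℕ; zero; suc; pred; _+_; _≤_; _≥_; _<_; z≤n; s≤s; _≤ᵇ_; _≡ᵇ_; _≟_; _≤?_; _<?_)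
  renaming (_⊔_ to _⊔ⁿ_)
open import Data.Nat.ListAction using (sum)
open import Data.Nat.Properties
open import Data.Product using (Σ; _×_; _,_; proj₁; proj₂)
import Data.Product as Product
open import Data.Sum using (_⊎_; inj₁; inj₂)
open import Data.Unit using (⊤; tt)
open import Function using (_⇔_; _∘_; id; Equivalence; mk⇔)
open import Relation.Binary using (DecidableEquality; DecTotalOrder)
open import Relation.Binary.PropositionalEquality
  using (_≡_; _≢_; refl; sym; trans; cong; cong₂; subst; module ≡-Reasoning)
open import Relation.Nullary using (¬_; Dec; yes; no; does)
open import Relation.Nullary.Decidable using (T?; dec-true; dec-false)

-- Restricted growth words

data RGFrom : ℕ → Word → Set where
  []   : ∀ {m} → RGFrom m []
  cons : ∀ {m x xs} → 1 ≤ x → x ≤ suc m → RGFrom (m ⊔ⁿ x) xs → RGFrom m (x ∷ xs)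

T-isRGfrom⇒RGFrom : ∀ m w → T (isRGfrom m w) → RGFrom m w
T-isRGfrom⇒RGFrom m []       _ = []
T-isRGfrom⇒RGFrom m (x ∷ xs) t =
  let 1≤x , t′ = Equivalence.to (T-∧ {1 ≤ᵇ x}) t
      x≤1+m , t″ = Equivalence.to (T-∧ {x ≤ᵇ suc m}) t′
  in cons (≤ᵇ⇒≤ 1 x 1≤x) (≤ᵇ⇒≤ x (suc m) x≤1+m) (T-isRGfrom⇒RGFrom (m ⊔ⁿ x) xs t″)

RGFrom⇒T-isRGfrom : ∀ {m w} → RGFrom m w → T (isRGfrom m w)
RGFrom⇒T-isRGfrom []           = _
RGFrom⇒T-isRGfrom (cons p q r) = Equivalence.from T-∧ (≤⇒≤ᵇ p , Equivalence.from T-∧ (≤⇒≤ᵇ q , RGFrom⇒T-isRGfrom r))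

IsRG⇒RGFrom : ∀ {w} → IsRG w → RGFrom 0 w
IsRG⇒RGFrom r = T-isRGfrom⇒RGFrom 0 _ (Equivalence.from T-≡ r)

RGFrom⇒IsRG : ∀ {w} → RGFrom 0 w → IsRG w
RGFrom⇒IsRG r = Equivalence.to T-≡ (RGFrom⇒T-isRGfrom r)

RGFrom-mono : ∀ {m m′ w} → m ≤ m′ → RGFrom m w → RGFrom m′ w
RGFrom-mono le []           = []
RGFrom-mono le (cons p q r) = cons p (≤-trans q (s≤s le)) (RGFrom-mono (⊔-monoˡ-≤ _ le) r)

maxLetter-++ : ∀ u v → maxLetter (u ++ v) ≡ maxLetter u ⊔ⁿ maxLetter v
maxLetter-++ []      v = refl
maxLetter-++ (x ∷ u) v = trans (cong (x ⊔ⁿ_) (maxLetter-++ u v)) (sym (⊔-assoc x (maxLetter u) (maxLetter v)))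

RGFrom-++⁻ˡ : ∀ {m} u {v} → RGFrom m (u ++ v) → RGFrom m u
RGFrom-++⁻ˡ []      _            = []
RGFrom-++⁻ˡ (x ∷ u) (cons p q r) = cons p q (RGFrom-++⁻ˡ u r)

RGFrom-++⁻ʳ : ∀ {m} u {v} → RGFrom m (u ++ v) → RGFrom (m ⊔ⁿ maxLetter u) v
RGFrom-++⁻ʳ {m} []      r            = subst (λ k → RGFrom k _) (sym (⊔-identityʳ m)) r
RGFrom-++⁻ʳ {m} (x ∷ u) (cons p q r) =
  subst (λ k → RGFrom k _) (⊔-assoc m x (maxLetter u)) (RGFrom-++⁻ʳ u r)

RGFrom-++⁺ : ∀ {m} u {v} → RGFrom m u → RGFrom (m ⊔ⁿ maxLetter u) v → RGFrom m (u ++ v)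
RGFrom-++⁺ {m} []      _            r′ = subst (λ k → RGFrom k _) (⊔-identityʳ m) r′
RGFrom-++⁺ {m} (x ∷ u) (cons p q r) r′ =
  cons p q (RGFrom-++⁺ u r (subst (λ k → RGFrom k _) (sym (⊔-assoc m x (maxLetter u))) r′))

IsRG-++⁺ : ∀ u v → IsRG u → IsRG v → IsRG (u ++ v)
IsRG-++⁺ u v p q = RGFrom⇒IsRG (RGFrom-++⁺ u (IsRG⇒RGFrom p) (RGFrom-mono z≤n (IsRG⇒RGFrom q)))

IsRG-++⁻ˡ : ∀ u v → IsRG (u ++ v) → IsRG u
IsRG-++⁻ˡ u v p = RGFrom⇒IsRG (RGFrom-++⁻ˡ u (IsRG⇒RGFrom p))

IsRG-concat⁺ : ∀ vs → All IsRG vs → IsRG (concat vs)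
IsRG-concat⁺ []       []       = refl
IsRG-concat⁺ (v ∷ vs) (r ∷ rs) = IsRG-++⁺ v (concat vs) r (IsRG-concat⁺ vs rs)

isRG-++-IsRG : ∀ u v → IsRG v → isRG (u ++ v) ≡ isRG u
isRG-++-IsRG u v q with isRG u in eq
... | true = IsRG-++⁺ u v eq q
... | false with isRG (u ++ v) in eq′
...   | true  = trans (sym (IsRG-++⁻ˡ u v eq′)) eq
...   | false = refl

RGFrom-positive : ∀ {m w} → RGFrom m w → All (1 ≤_) w
RGFrom-positive []           = []
RGFrom-positive (cons p _ r) = p ∷ RGFrom-positive r

RGFrom-letter∈ : ∀ {m w} → RGFrom m w → ∀ j → j ≤ m ⊔ⁿ maxLetter w → j ≤ m ⊎ j ∈ w
RGFrom-letter∈ {m} []                  j le = inj₁ (subst (j ≤_) (⊔-identityʳ m) le)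
RGFrom-letter∈ {m} {x ∷ xs} (cons _ q r) j le
  with RGFrom-letter∈ r j (subst (j ≤_) (sym (⊔-assoc m x (maxLetter xs))) le)
... | inj₂ j∈xs = inj₂ (there j∈xs)
... | inj₁ j≤m⊔x with ⊔-sel m x
...   | inj₁ m⊔x≡m = inj₁ (subst (j ≤_) m⊔x≡m j≤m⊔x)
...   | inj₂ m⊔x≡x with j ≤? m
...     | yes j≤m = inj₁ j≤m
...     | no  j≰m = inj₂ (here (≤-antisym (subst (j ≤_) m⊔x≡x j≤m⊔x) (≤-trans q (≰⇒> j≰m))))

IsRG-letter∈ : ∀ {w} → IsRG w → ∀ {j} → 1 ≤ j → j ≤ maxLetter w → j ∈ w
IsRG-letter∈ r {j} 1≤j le with RGFrom-letter∈ (IsRG⇒RGFrom r) j le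
... | inj₁ j≤0  = ⊥-elim (<⇒≱ 1≤j j≤0)
... | inj₂ j∈w = j∈w

-- Maximal splitting

splitFrom-++-IsRG : ∀ acc w v → IsRG v → splitFrom acc (w ++ v) ≡ splitFrom acc w ++ maximalSplitting v
splitFrom-++-IsRG []      [] []      _ = refl
splitFrom-++-IsRG (_ ∷ _) [] []      _ = refl
splitFrom-++-IsRG []      [] (_ ∷ _) _ = refl
splitFrom-++-IsRG (_ ∷ _) [] (_ ∷ _) q rewrite q = refl
splitFrom-++-IsRG acc (x ∷ w) v q rewrite isRG-++-IsRG (x ∷ w) v q with not (null acc) ∧ isRG (x ∷ w)
... | true  = cong (acc ∷_) (splitFrom-++-IsRG [ x ] w v q)
... | false = splitFrom-++-IsRG (acc ++ [ x ]) w v q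

concat-splitFrom : ∀ acc w → concat (splitFrom acc w) ≡ acc ++ w
concat-splitFrom []      []      = refl
concat-splitFrom (_ ∷ _) []      = refl
concat-splitFrom acc     (x ∷ w) with not (null acc) ∧ isRG (x ∷ w)
... | true  = cong (acc ++_) (concat-splitFrom [ x ] w)
... | false = trans (concat-splitFrom (acc ++ [ x ]) w) (List.++-assoc acc [ x ] w)

concat-maximalSplitting : ∀ w → concat (maximalSplitting w) ≡ w
concat-maximalSplitting = concat-splitFrom []

IsPrimary : Word → Set
IsPrimary q = IsRG q × maximalSplitting q ≡ [ q ]

-- The invariant of splitFrom (a ∷ as) w: no cut was possible inside as, i.e. s ++ w is not a
-- restricted growth word for any nonempty suffix s of as.
NoRGSuffix : Word → Word → Set
NoRGSuffix []       w = ⊤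
NoRGSuffix (y ∷ ys) w = isRG (y ∷ ys ++ w) ≡ false × NoRGSuffix ys w

NoRGSuffix-snoc : ∀ as x xs → NoRGSuffix as (x ∷ xs) → isRG (x ∷ xs) ≡ false → NoRGSuffix (as ++ [ x ]) xs
NoRGSuffix-snoc []       x xs _        f = f , tt
NoRGSuffix-snoc (y ∷ ys) x xs (p , ns) f =
  subst (λ k → isRG (y ∷ k) ≡ false) (sym (List.++-assoc ys [ x ] xs)) p , NoRGSuffix-snoc ys x xs ns f

NoRGSuffix-drop : ∀ as w → IsRG w → NoRGSuffix as w → NoRGSuffix as []
NoRGSuffix-drop []       w q _        = tt
NoRGSuffix-drop (y ∷ ys) w q (p , ns) =
  trans (cong isRG (List.++-identityʳ (y ∷ ys))) (trans (sym (isRG-++-IsRG (y ∷ ys) w q)) p) ,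
  NoRGSuffix-drop ys w q ns

splitFrom-NoRGSuffix : ∀ b bs as → NoRGSuffix as [] → splitFrom (b ∷ bs) as ≡ [ b ∷ bs ++ as ]
splitFrom-NoRGSuffix b bs []       _        = cong (λ k → [ b ∷ k ]) (sym (List.++-identityʳ bs))
splitFrom-NoRGSuffix b bs (y ∷ ys) (p , ns)
  rewrite trans (cong isRG (sym (List.++-identityʳ (y ∷ ys)))) p =
  trans (splitFrom-NoRGSuffix b (bs ++ [ y ]) ys ns) (cong (λ k → [ b ∷ k ]) (List.++-assoc bs [ y ] ys))

splitFrom-primary : ∀ a as w → IsRG ((a ∷ as) ++ w) → NoRGSuffix as w → All IsPrimary (splitFrom (a ∷ as) w)
splitFrom-primary a as [] r ns =
  (IsRG-++⁻ˡ (a ∷ as) [] r , splitFrom-NoRGSuffix a [] as (NoRGSuffix-drop as [] refl ns)) ∷ []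
splitFrom-primary a as (x ∷ xs) r ns with isRG (x ∷ xs) in eq
... | true  = (IsRG-++⁻ˡ (a ∷ as) (x ∷ xs) r , splitFrom-NoRGSuffix a [] as (NoRGSuffix-drop as (x ∷ xs) eq ns))
            ∷ splitFrom-primary x [] xs
                (IsRG-++⁻ˡ (x ∷ xs) [] (trans (cong isRG (List.++-identityʳ (x ∷ xs))) eq)) tt
... | false = splitFrom-primary a (as ++ [ x ]) xs
                (subst (λ k → IsRG (a ∷ k)) (sym (List.++-assoc as [ x ] xs)) r) (NoRGSuffix-snoc as x xs ns eq)

maximalSplitting-primary : ∀ w → IsRG w → All IsPrimary (maximalSplitting w)
maximalSplitting-primary []       _ = []
maximalSplitting-primary (x ∷ xs) r = splitFrom-primary x [] xs r tt

maximalSplitting-concat : ∀ qs → All IsPrimary qs → maximalSplitting (concat qs) ≡ qs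
maximalSplitting-concat []       []              = refl
maximalSplitting-concat (q ∷ qs) ((r , s) ∷ ps) = begin
  maximalSplitting (q ++ concat qs)
    ≡⟨ splitFrom-++-IsRG [] q (concat qs) (IsRG-concat⁺ qs (All.map proj₁ ps)) ⟩
  maximalSplitting q ++ maximalSplitting (concat qs)
    ≡⟨ cong₂ _++_ s (maximalSplitting-concat qs ps) ⟩
  q ∷ qs ∎
  where open ≡-Reasoning

-- Partitions and convex words

T-does⇒ : ∀ {p} {P : Set p} (d : Dec P) → T (does d) → P
T-does⇒ (yes p) _ = p

Partition : List ℕ → Set
Partition μ = All (1 ≤_) μ × Linked _≥_ μ

T-nonincr⇒Linked : ∀ μ → T (nonincr μ) → Linked _≥_ μ
T-nonincr⇒Linked []           _ = []
T-nonincr⇒Linked (x ∷ [])     _ = [-]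
T-nonincr⇒Linked (x ∷ y ∷ xs) t =
  let y≤x , t′ = Equivalence.to (T-∧ {y ≤ᵇ x}) t in ≤ᵇ⇒≤ y x y≤x ∷ T-nonincr⇒Linked (y ∷ xs) t′

Linked⇒T-nonincr : ∀ {μ} → Linked _≥_ μ → T (nonincr μ)
Linked⇒T-nonincr []         = _
Linked⇒T-nonincr [-]        = _
Linked⇒T-nonincr (y≤x ∷ ni) = Equivalence.from T-∧ (≤⇒≤ᵇ y≤x , Linked⇒T-nonincr ni)

T-isPartition⇒Partition : ∀ μ → T (isPartition μ) → Partition μ
T-isPartition⇒Partition μ t with Equivalence.to (T-∧ {all (1 ≤ᵇ_) μ}) t
... | pos , ni = All.map (≤ᵇ⇒≤ 1 _) (All.all⁺ (1 ≤ᵇ_) μ pos) , T-nonincr⇒Linked μ ni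

Partition⇒T-isPartition : ∀ {μ} → Partition μ → T (isPartition μ)
Partition⇒T-isPartition (pos , ni) =
  Equivalence.from T-∧ (All.all⁻ (1 ≤ᵇ_) (All.map ≤⇒≤ᵇ pos) , Linked⇒T-nonincr ni)

Partition⇒isPartition : ∀ {μ} → Partition μ → isPartition μ ≡ true
Partition⇒isPartition pμ = Equivalence.to T-≡ (Partition⇒T-isPartition pμ)

isPartition⇒Partition : ∀ μ → isPartition μ ≡ true → Partition μ
isPartition⇒Partition μ e = T-isPartition⇒Partition μ (Equivalence.from T-≡ e)

length-wordOfFrom : ∀ i μ → length (wordOfFrom i μ) ≡ sum μ
length-wordOfFrom i []      = refl
length-wordOfFrom i (m ∷ μ) =
  trans (List.length-++ (replicate m (suc i))) (cong₂ _+_ (List.length-replicate m) (length-wordOfFrom (suc i) μ))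

maxLetter-replicate : ∀ m a → 1 ≤ m → maxLetter (replicate m a) ≡ a
maxLetter-replicate (suc zero)    a _ = ⊔-identityʳ a
maxLetter-replicate (suc (suc m)) a _ = trans (cong (a ⊔ⁿ_) (maxLetter-replicate (suc m) a (s≤s z≤n))) (⊔-idem a)

RGFrom-replicate : ∀ m a j → a ≤ suc j → 1 ≤ a → RGFrom j (replicate m a)
RGFrom-replicate zero    a j le p = []
RGFrom-replicate (suc m) a j le p = cons p le (RGFrom-replicate m a (j ⊔ⁿ a) (≤-trans le (s≤s (m≤m⊔n j a))) p)

RGFrom-wordOfFrom : ∀ i j μ → i ≤ j → All (1 ≤_) μ → RGFrom j (wordOfFrom i μ)
RGFrom-wordOfFrom i j []      le _        = []
RGFrom-wordOfFrom i j (m ∷ μ) le (p ∷ ps) =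
  RGFrom-++⁺ (replicate m (suc i)) (RGFrom-replicate m (suc i) j (s≤s le) (s≤s z≤n))
    (RGFrom-wordOfFrom (suc i) _ μ
      (subst (suc i ≤_) (sym (cong (j ⊔ⁿ_) (maxLetter-replicate m (suc i) p))) (m≤n⊔m j (suc i))) ps)

IsRG-wordOf : ∀ μ → All (1 ≤_) μ → IsRG (wordOf μ)
IsRG-wordOf μ ps = RGFrom⇒IsRG (RGFrom-wordOfFrom 0 0 μ ≤-refl ps)

maxLetter-wordOfFrom : ∀ i μ → All (1 ≤_) μ → i ⊔ⁿ maxLetter (wordOfFrom i μ) ≡ i + length μ
maxLetter-wordOfFrom i []      _        = trans (⊔-identityʳ i) (sym (+-identityʳ i))
maxLetter-wordOfFrom i (m ∷ μ) (p ∷ ps) = begin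
  i ⊔ⁿ maxLetter (replicate m (suc i) ++ rest)
    ≡⟨ cong (i ⊔ⁿ_) (maxLetter-++ (replicate m (suc i)) rest) ⟩
  i ⊔ⁿ (maxLetter (replicate m (suc i)) ⊔ⁿ maxLetter rest)
    ≡⟨ cong (λ k → i ⊔ⁿ (k ⊔ⁿ maxLetter rest)) (maxLetter-replicate m (suc i) p) ⟩
  i ⊔ⁿ (suc i ⊔ⁿ maxLetter rest)      ≡⟨ sym (⊔-assoc i (suc i) _) ⟩
  (i ⊔ⁿ suc i) ⊔ⁿ maxLetter rest      ≡⟨ cong (_⊔ⁿ maxLetter rest) (m≤n⇒m⊔n≡n (n≤1+n i)) ⟩
  suc i ⊔ⁿ maxLetter rest             ≡⟨ maxLetter-wordOfFrom (suc i) μ ps ⟩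
  suc i + length μ                    ≡⟨ sym (+-suc i (length μ)) ⟩
  i + suc (length μ)                  ∎
  where
  rest = wordOfFrom (suc i) μ
  open ≡-Reasoning

maxLetter-wordOf : ∀ {μ} → All (1 ≤_) μ → maxLetter (wordOf μ) ≡ length μ
maxLetter-wordOf ps = maxLetter-wordOfFrom 0 _ ps

candidatePartitions : ℕ → List (List ℕ)
candidatePartitions d = concatMap (listsOf d) (applyUpTo (λ k → k) (suc d))

isConvex⇒wordOf : ∀ t → isConvex t ≡ true → Σ (List ℕ) λ μ → Partition μ × wordOf μ ≡ t
isConvex⇒wordOf t e
  with find (Any.any⁻ (λ μ → wordOf μ == t) (partitionsOf (length t)) (Equivalence.from T-≡ e))
... | μ , μ∈ , μ==t
  with ∈-filter⁻ (T? ∘ λ ν → isPartition ν ∧ (sum ν ≡ᵇ length t)) {xs = candidatePartitions (length t)} μ∈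
...   | _ , t-μ =
  μ , T-isPartition⇒Partition μ (proj₁ (Equivalence.to T-∧ t-μ)) , T-does⇒ (List.≡-dec _≟_ _ _) μ==t

∈-listsOf : ∀ d μ → All (λ x → 1 ≤ x × x ≤ d) μ → μ ∈ listsOf d (length μ)
∈-listsOf d []          _                = here refl
∈-listsOf d (suc x ∷ μ) ((_ , x<d) ∷ ps) =
  ∈-concatMap⁺ (λ l → map (_∷ l) (applyUpTo suc d)) (lose (∈-listsOf d μ ps) (∈-map⁺ (_∷ μ) (∈-applyUpTo⁺ suc x<d)))

parts≤sum : ∀ μ → All (1 ≤_) μ → All (λ x → 1 ≤ x × x ≤ sum μ) μ
parts≤sum []      _        = []
parts≤sum (x ∷ μ) (p ∷ ps) =
  (p , m≤m+n x (sum μ)) ∷ All.map (λ (q , le) → q , ≤-trans le (m≤n+m (sum μ) x)) (parts≤sum μ ps)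

length≤sum : ∀ μ → All (1 ≤_) μ → length μ ≤ sum μ
length≤sum []      _        = z≤n
length≤sum (x ∷ μ) (p ∷ ps) = +-mono-≤ p (length≤sum μ ps)

wordOf-isConvex : ∀ {μ} → Partition μ → isConvex (wordOf μ) ≡ true
wordOf-isConvex {μ} pμ@(pos , _) = Equivalence.to T-≡
  (Any.any⁺ (λ ν → wordOf ν == wordOf μ)
    (lose μ∈ (Equivalence.from T-≡ (dec-true (List.≡-dec _≟_ (wordOf μ) (wordOf μ)) refl))))
  where
  μ∈ : μ ∈ partitionsOf (length (wordOf μ))
  μ∈ rewrite length-wordOfFrom 0 μ =
    ∈-filter⁺ (T? ∘ λ ν → isPartition ν ∧ (sum ν ≡ᵇ sum μ))
      (∈-concatMap⁺ (listsOf (sum μ))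
        (lose (∈-applyUpTo⁺ (λ k → k) (s≤s (length≤sum μ pos))) (∈-listsOf (sum μ) μ (parts≤sum μ pos))))
      (Equivalence.from T-∧ (Partition⇒T-isPartition pμ , ≡⇒≡ᵇ (sum μ) (sum μ) refl))

replicate-++-split : ∀ m (a : ℕ) r u v → replicate m a ++ r ≡ u ++ v →
  (Σ ℕ λ k → k ≤ m × u ≡ replicate k a) ⊎ (Σ Word λ u′ → u ≡ replicate m a ++ u′ × r ≡ u′ ++ v)
replicate-++-split zero    a r u       v e = inj₂ (u , refl , e)
replicate-++-split (suc m) a r []      v e = inj₁ (0 , z≤n , refl)
replicate-++-split (suc m) a r (x ∷ u) v e with List.∷-injective e
... | refl , e′ with replicate-++-split m a r u v e′
...   | inj₁ (k , k≤m , u≡)       = inj₁ (suc k , s≤s k≤m , cong (a ∷_) u≡)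
...   | inj₂ (u′ , u≡ , r≡)       = inj₂ (u′ , cong (a ∷_) u≡ , r≡)

-- The partitions μ′ for which wordOf μ′ is a prefix of wordOf μ.
data Truncation : List ℕ → List ℕ → Set where
  []      : ∀ {μ} → Truncation [] μ
  shorten : ∀ {x y ys} → 1 ≤ x → x ≤ y → Truncation (x ∷ []) (y ∷ ys)
  keep    : ∀ {x xs ys} → Truncation xs ys → Truncation (x ∷ xs) (x ∷ ys)

Truncation-head : ∀ {x xs y ys} → Truncation (x ∷ xs) (y ∷ ys) → x ≤ y
Truncation-head (shorten _ le) = le
Truncation-head (keep _)       = ≤-refl

Truncation-partition : ∀ {μ′ μ} → Partition μ → Truncation μ′ μ → Partition μ′
Truncation-partition _                []             = [] , []
Truncation-partition _                (shorten p _)  = p ∷ [] , [-]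
Truncation-partition (p ∷ ps , ni)    (keep {xs = []} _) = p ∷ [] , [-]
Truncation-partition (p ∷ ps , y≤x ∷ ni) (keep {xs = _ ∷ _} tr) with Truncation-partition (ps , ni) tr
... | ps′ , ni′ = p ∷ ps′ , ≤-trans (Truncation-head tr) y≤x ∷ ni′

wordOfFrom-prefix : ∀ i μ u v → All (1 ≤_) μ → wordOfFrom i μ ≡ u ++ v →
  Σ (List ℕ) λ μ′ → wordOfFrom i μ′ ≡ u × Truncation μ′ μ
wordOfFrom-prefix i []      [] v _        e = [] , refl , []
wordOfFrom-prefix i (m ∷ μ) u  v (p ∷ ps) e with replicate-++-split m (suc i) (wordOfFrom (suc i) μ) u v e
... | inj₁ (zero  , _    , u≡) = [] , sym u≡ , []
... | inj₁ (suc k , k≤m  , u≡) = suc k ∷ [] , trans (List.++-identityʳ _) (sym u≡) , shorten (s≤s z≤n) k≤m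
... | inj₂ (u′ , u≡ , r≡) with wordOfFrom-prefix (suc i) μ u′ v ps r≡
...   | μ′ , w≡ , tr = m ∷ μ′ , trans (cong (replicate m (suc i) ++_) w≡) (sym u≡) , keep tr

isConvex-++⁻ˡ : ∀ u v → isConvex (u ++ v) ≡ true → isConvex u ≡ true
isConvex-++⁻ˡ u v c with isConvex⇒wordOf (u ++ v) c
... | μ , pμ , e with wordOfFrom-prefix 0 μ u v (proj₁ pμ) e
...   | μ′ , e′ , tr = subst (λ k → isConvex k ≡ true) e′ (wordOf-isConvex (Truncation-partition pμ tr))

NotHeadedBy : ℕ → Word → Set
NotHeadedBy a r = ∀ r₀ → r ≢ a ∷ r₀

replicate-++-injective : ∀ m m′ (a : ℕ) r r′ → NotHeadedBy a r → NotHeadedBy a r′ →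
  replicate m a ++ r ≡ replicate m′ a ++ r′ → m ≡ m′ × r ≡ r′
replicate-++-injective zero    zero     a r r′ h h′ e = refl , e
replicate-++-injective zero    (suc m′) a r r′ h h′ e = ⊥-elim (h _ e)
replicate-++-injective (suc m) zero     a r r′ h h′ e = ⊥-elim (h′ _ (sym e))
replicate-++-injective (suc m) (suc m′) a r r′ h h′ e
  with replicate-++-injective m m′ a r r′ h h′ (proj₂ (List.∷-injective e))
... | m≡m′ , r≡r′ = cong suc m≡m′ , r≡r′

wordOfFrom-NotHeadedBy : ∀ i μ → All (1 ≤_) μ → NotHeadedBy (suc i) (wordOfFrom (suc i) μ)
wordOfFrom-NotHeadedBy i (suc m ∷ μ) (p ∷ ps) r₀ e with List.∷-injective e
... | () , _

wordOfFrom-injective : ∀ i μ μ′ → All (1 ≤_) μ → All (1 ≤_) μ′ → wordOfFrom i μ ≡ wordOfFrom i μ′ → μ ≡ μ′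
wordOfFrom-injective i []          []           _        _          e  = refl
wordOfFrom-injective i []          (suc m ∷ μ′) _        _          ()
wordOfFrom-injective i (suc m ∷ μ) []           _        _          ()
wordOfFrom-injective i []          (zero ∷ μ′)  _        (() ∷ _)   _
wordOfFrom-injective i (zero ∷ μ)  []           (() ∷ _) _          _
wordOfFrom-injective i (m ∷ μ)     (m′ ∷ μ′)    (p ∷ ps) (p′ ∷ ps′) e
  with replicate-++-injective m m′ (suc i) _ _ (wordOfFrom-NotHeadedBy i μ ps) (wordOfFrom-NotHeadedBy i μ′ ps′) e
... | refl , e′ = cong (m ∷_) (wordOfFrom-injective (suc i) μ μ′ ps ps′ e′)

-- Bimodal decomposition

bimodalTail : Word → Word
bimodalTail w = proj₂ (bimodalDecomposition w)

bimodalFrom-++ : ∀ acc ps qs → bimodalFrom acc (ps ++ qs) ≡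
  (proj₁ (bimodalFrom acc ps) ++ proj₁ (bimodalFrom (proj₂ (bimodalFrom acc ps)) qs) ,
   proj₂ (bimodalFrom (proj₂ (bimodalFrom acc ps)) qs))
bimodalFrom-++ acc []       qs = refl
bimodalFrom-++ acc (p ∷ ps) qs with isConvex (acc ++ p)
... | true  = bimodalFrom-++ (acc ++ p) ps qs
... | false rewrite bimodalFrom-++ [] ps qs = refl

concat-bimodalFrom : ∀ acc ps → concat (proj₁ (bimodalFrom acc ps)) ++ proj₂ (bimodalFrom acc ps) ≡ acc ++ concat ps
concat-bimodalFrom acc []       = sym (List.++-identityʳ acc)
concat-bimodalFrom acc (p ∷ ps) with isConvex (acc ++ p)
... | true  = trans (concat-bimodalFrom (acc ++ p) ps) (List.++-assoc acc p (concat ps))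
... | false = trans (List.++-assoc (acc ++ p) _ _)
                (trans (cong ((acc ++ p) ++_) (concat-bimodalFrom [] ps)) (List.++-assoc acc p (concat ps)))

concat-bimodalDecomposition : ∀ w → concat (bimodalFactors w) ++ bimodalTail w ≡ w
concat-bimodalDecomposition w = trans (concat-bimodalFrom [] (maximalSplitting w)) (concat-maximalSplitting w)

concat-bimodalFactors : ∀ w → IsTailFree w → concat (bimodalFactors w) ≡ w
concat-bimodalFactors w tf =
  trans (sym (List.++-identityʳ _))
    (trans (cong (concat (bimodalFactors w) ++_) (sym tf)) (concat-bimodalDecomposition w))

bimodalFrom-tail-isConvex : ∀ acc ps → isConvex acc ≡ true → isConvex (proj₂ (bimodalFrom acc ps)) ≡ true
bimodalFrom-tail-isConvex acc []       c = c
bimodalFrom-tail-isConvex acc (p ∷ ps) c with isConvex (acc ++ p) in eq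
... | true  = bimodalFrom-tail-isConvex (acc ++ p) ps eq
... | false = bimodalFrom-tail-isConvex [] ps refl

bimodalTail-isConvex : ∀ w → isConvex (bimodalTail w) ≡ true
bimodalTail-isConvex w = bimodalFrom-tail-isConvex [] (maximalSplitting w) refl

bimodalFrom-convex-step : ∀ acc p ps → isConvex (acc ++ p) ≡ true →
  bimodalFrom acc (p ∷ ps) ≡ bimodalFrom (acc ++ p) ps
bimodalFrom-convex-step acc p ps c rewrite c = refl

bimodalFrom-nonconvex-step : ∀ acc p ps → isConvex (acc ++ p) ≡ false →
  bimodalFrom acc (p ∷ ps) ≡ ((acc ++ p) ∷ proj₁ (bimodalFrom [] ps) , proj₂ (bimodalFrom [] ps))
bimodalFrom-nonconvex-step acc p ps c rewrite c = refl

-- A run of primary words that the scan accumulates without closing a factor.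
ConvexRun : List Word → Set
ConvexRun as = bimodalFrom [] as ≡ ([] , concat as)

concat-∷ʳ : ∀ (as : List Word) p → concat (as ++ [ p ]) ≡ concat as ++ p
concat-∷ʳ as p = trans (sym (List.concat-++ as [ p ])) (cong (concat as ++_) (List.++-identityʳ p))

bimodalFrom-∷ʳ : ∀ as p → ConvexRun as → bimodalFrom [] (as ++ [ p ]) ≡ bimodalFrom (concat as) [ p ]
bimodalFrom-∷ʳ as p run rewrite bimodalFrom-++ [] as [ p ] | run = refl

ConvexRun-∷ʳ : ∀ as p → ConvexRun as → isConvex (concat as ++ p) ≡ true → ConvexRun (as ++ [ p ])
ConvexRun-∷ʳ as p run c =
  trans (bimodalFrom-∷ʳ as p run)
    (trans (bimodalFrom-convex-step (concat as) p [] c) (cong ([] ,_) (sym (concat-∷ʳ as p))))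

bimodalFrom-factors-bimodal : ∀ as ps → All IsPrimary as → All IsPrimary ps → ConvexRun as →
  All IsBimodal (proj₁ (bimodalFrom (concat as) ps))
bimodalFrom-factors-bimodal as []       _  _          _   = []
bimodalFrom-factors-bimodal as (p ∷ ps) pa (pp ∷ pps) run with isConvex (concat as ++ p) in eq
... | true  = subst (λ k → All IsBimodal (proj₁ (bimodalFrom k ps))) (concat-∷ʳ as p)
                (bimodalFrom-factors-bimodal (as ++ [ p ]) ps (All.++⁺ pa (pp ∷ [])) pps (ConvexRun-∷ʳ as p run eq))
... | false = (subst IsRG (concat-∷ʳ as p) (IsRG-concat⁺ (as ++ [ p ]) (All.map proj₁ primaries)) , decomposition)
              ∷ bimodalFrom-factors-bimodal [] ps [] pps refl
  where
  primaries = All.++⁺ pa (pp ∷ [])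
  decomposition : bimodalDecomposition (concat as ++ p) ≡ ([ concat as ++ p ] , [])
  decomposition = begin
    bimodalFrom [] (maximalSplitting (concat as ++ p))
      ≡⟨ cong (λ k → bimodalFrom [] (maximalSplitting k)) (concat-∷ʳ as p) ⟨
    bimodalFrom [] (maximalSplitting (concat (as ++ [ p ])))
      ≡⟨ cong (bimodalFrom []) (maximalSplitting-concat (as ++ [ p ]) primaries) ⟩
    bimodalFrom [] (as ++ [ p ])   ≡⟨ bimodalFrom-∷ʳ as p run ⟩
    bimodalFrom (concat as) [ p ]  ≡⟨ bimodalFrom-nonconvex-step (concat as) p [] eq ⟩
    ([ concat as ++ p ] , [])      ∎
    where open ≡-Reasoning

bimodalFactors-bimodal : ∀ w → IsRG w → All IsBimodal (bimodalFactors w)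
bimodalFactors-bimodal w r =
  bimodalFrom-factors-bimodal [] (maximalSplitting w) [] (maximalSplitting-primary w r) refl

bimodalDecomposition-concat : ∀ vs → All IsBimodal vs → bimodalDecomposition (concat vs) ≡ (vs , [])
bimodalDecomposition-concat vs bs = trans (cong (bimodalFrom []) (splitting vs bs)) (scan vs bs)
  where
  splitting : ∀ vs → All IsBimodal vs → maximalSplitting (concat vs) ≡ concat (map maximalSplitting vs)
  splitting []       []             = refl
  splitting (v ∷ vs) ((r , _) ∷ bs) =
    trans (splitFrom-++-IsRG [] v (concat vs) (IsRG-concat⁺ vs (All.map proj₁ bs)))
      (cong (maximalSplitting v ++_) (splitting vs bs))
  scan : ∀ vs → All IsBimodal vs → bimodalFrom [] (concat (map maximalSplitting vs)) ≡ (vs , [])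
  scan []       []             = refl
  scan (v ∷ vs) ((_ , d) ∷ bs)
    rewrite bimodalFrom-++ [] (maximalSplitting v) (concat (map maximalSplitting vs)) | d | scan vs bs = refl

bimodalFrom-isConvex : ∀ acc ps → isConvex (acc ++ concat ps) ≡ true → bimodalFrom acc ps ≡ ([] , acc ++ concat ps)
bimodalFrom-isConvex acc []       c = cong ([] ,_) (sym (List.++-identityʳ acc))
bimodalFrom-isConvex acc (p ∷ ps) c = begin
  bimodalFrom acc (p ∷ ps)   ≡⟨ bimodalFrom-convex-step acc p ps (isConvex-++⁻ˡ (acc ++ p) (concat ps) c′) ⟩
  bimodalFrom (acc ++ p) ps  ≡⟨ bimodalFrom-isConvex (acc ++ p) ps c′ ⟩
  ([] , (acc ++ p) ++ concat ps) ≡⟨ cong ([] ,_) (List.++-assoc acc p (concat ps)) ⟩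
  ([] , acc ++ p ++ concat ps)   ∎
  where
  c′ = subst (λ k → isConvex k ≡ true) (sym (List.++-assoc acc p (concat ps))) c
  open ≡-Reasoning

bimodalDecomposition-++-wordOf : ∀ w μ → IsRG w → IsTailFree w → Partition μ →
  bimodalDecomposition (w ++ wordOf μ) ≡ (bimodalFactors w , wordOf μ)
bimodalDecomposition-++-wordOf w μ r tf pμ
  rewrite splitFrom-++-IsRG [] w (wordOf μ) (IsRG-wordOf μ (proj₁ pμ))
        | bimodalFrom-++ [] (maximalSplitting w) (maximalSplitting (wordOf μ)) | tf
        | bimodalFrom-isConvex [] (maximalSplitting (wordOf μ))
            (subst (λ k → isConvex k ≡ true) (sym (concat-maximalSplitting (wordOf μ))) (wordOf-isConvex pμ))
        | concat-maximalSplitting (wordOf μ) | List.++-identityʳ (bimodalFactors w) = refl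

∧-true⁺ : ∀ {a b} → a ≡ true → b ≡ true → a ∧ b ≡ true
∧-true⁺ refl refl = refl

∧-true⁻ : ∀ a {b} → a ∧ b ≡ true → a ≡ true × b ≡ true
∧-true⁻ true p = refl , p

take-length-++ : ∀ {A : Set} (v y : List A) → take (length v) (v ++ y) ≡ v
take-length-++ []      y = refl
take-length-++ (a ∷ v) y = cong (a ∷_) (take-length-++ v y)

drop-length-++ : ∀ {A : Set} (v y : List A) → drop (length v) (v ++ y) ≡ y
drop-length-++ []      y = refl
drop-length-++ (a ∷ v) y = drop-length-++ v y

take-map-++ : ∀ {A B : Set} (g : A → B) xs ys → take (length xs) (map g xs ++ ys) ≡ map g xs
take-map-++ g xs ys =
  subst (λ k → take k (map g xs ++ ys) ≡ map g xs) (List.length-map g xs) (take-length-++ (map g xs) ys)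

drop-map-++ : ∀ {A B : Set} (g : A → B) xs ys → drop (length xs) (map g xs ++ ys) ≡ ys
drop-map-++ g xs ys =
  subst (λ k → drop k (map g xs ++ ys) ≡ ys) (List.length-map g xs) (drop-length-++ (map g xs) ys)

≡ᵇ-true : ∀ {a b} → a ≡ b → (a ≡ᵇ b) ≡ true
≡ᵇ-true {a} {b} e = Equivalence.to T-≡ (≡⇒≡ᵇ a b e)

module _ {A : Set} (_≟_ : DecidableEquality A) where

  occurrences : A → List A → ℕ
  occurrences u []      = 0
  occurrences u (v ∷ l) = if does (v ≟ u) then suc (occurrences u l) else occurrences u l

  occurrences-++ : ∀ u l l′ → occurrences u (l ++ l′) ≡ occurrences u l + occurrences u l′
  occurrences-++ u []      l′ = refl
  occurrences-++ u (v ∷ l) l′ with does (v ≟ u)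
  ... | true  = cong suc (occurrences-++ u l l′)
  ... | false = occurrences-++ u l l′

  occurrences-filterᵇ : ∀ (p : A → Bool) u l → occurrences u (filterᵇ p l) ≡ (if p u then occurrences u l else 0)
  occurrences-filterᵇ p u l with p u in pu
  ... | true  = kept l
    where
    kept : ∀ l → occurrences u (filterᵇ p l) ≡ occurrences u l
    kept []      = refl
    kept (v ∷ l) with p v in pv
    ... | true with does (v ≟ u)
    ...   | true  = cong suc (kept l)
    ...   | false = kept l
    kept (v ∷ l) | false with v ≟ u
    ...   | yes refl with () ← trans (sym pu) pv
    ...   | no _     = kept l
  ... | false = dropped l
    where
    dropped : ∀ l → occurrences u (filterᵇ p l) ≡ 0
    dropped []      = refl
    dropped (v ∷ l) with p v in pv
    ... | false = dropped l
    ... | true with v ≟ u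
    ...   | yes refl with () ← trans (sym pv) pu
    ...   | no _     = dropped l

occurrences-suc : ∀ {k} (x : Fin k) l → occurrences Fin._≟_ (Fin.suc x) (map Fin.suc l) ≡ occurrences Fin._≟_ x l
occurrences-suc x []      = refl
occurrences-suc x (y ∷ l) with does (y Fin.≟ x)
... | true  = cong suc (occurrences-suc x l)
... | false = occurrences-suc x l

occurrences-zero : ∀ {k} (l : List (Fin k)) → occurrences Fin._≟_ Fin.zero (map Fin.suc l) ≡ 0
occurrences-zero []      = refl
occurrences-zero (y ∷ l) = occurrences-zero l

occurrences-allFin : ∀ k (x : Fin k) → occurrences Fin._≟_ x (allFin k) ≡ 1
occurrences-allFin (suc k) Fin.zero    =
  cong suc (trans (cong (occurrences Fin._≟_ Fin.zero) (sym (List.map-tabulate {n = k} id Fin.suc)))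
                  (occurrences-zero (allFin k)))
occurrences-allFin (suc k) (Fin.suc x) =
  trans (cong (occurrences Fin._≟_ (Fin.suc x)) (sym (List.map-tabulate {n = k} id Fin.suc)))
    (trans (occurrences-suc x (allFin k)) (occurrences-allFin k x))

length-extract : ∀ {a} {A : Set a} (xs : List A) y ys → length (xs ++ y ∷ ys) ≡ suc (length (xs ++ ys))
length-extract []       y ys = refl
length-extract (x ∷ xs) y ys = cong suc (length-extract xs y ys)

All-extract : ∀ {a q} {A : Set a} {Q : A → Set q} xs {y ys} → All Q (xs ++ y ∷ ys) → All Q (xs ++ ys) × Q y
All-extract xs qs with All.++⁻ˡ xs qs | All.++⁻ʳ xs qs
... | qxs | qy ∷ qys = All.++⁺ qxs qys , qy

All-insert : ∀ {a q} {A : Set a} {Q : A → Set q} xs {y ys} → All Q (xs ++ ys) → Q y → All Q (xs ++ y ∷ ys)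
All-insert xs qs qy = All.++⁺ (All.++⁻ˡ xs qs) (qy ∷ All.++⁻ʳ xs qs)

Unique-map-extract : ∀ {a b} {A : Set a} {B : Set b} (f : A → B) xs {y ys} → Unique (map f (xs ++ y ∷ ys)) →
  Unique (map f (xs ++ ys)) × All (λ x → f x ≢ f y) (xs ++ ys)
Unique-map-extract f []       (fy≢ ∷ u) = u , All.map⁻ (All.map (λ fy≢fx fx≡fy → fy≢fx (sym fx≡fy)) fy≢)
Unique-map-extract f (x ∷ xs) (fx≢ ∷ u) with Unique-map-extract f xs u | All-extract xs (All.map⁻ fx≢)
... | u′ , ≢fy | fx≢rest , fx≢fy = All.map⁺ fx≢rest ∷ u′ , fx≢fy ∷ ≢fy

-- Lexicographic minimality of restricted growth words

infix 4 _≤ˡᵉˣ_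
_≤ˡᵉˣ_ : Word → Word → Set
_≤ˡᵉˣ_ = Lex-≤ _≡_ _<_

module ≤ˡᵉˣ = DecTotalOrder (Lex.≤-decTotalOrder <-strictTotalOrder)

≤ˡᵉˣ-++ : ∀ {f u fs us} → f ≤ˡᵉˣ u → length f ≡ length u → fs ≤ˡᵉˣ us → f ++ fs ≤ˡᵉˣ u ++ us
≤ˡᵉˣ-++ {u = []}    (base _)   _   q = q
≤ˡᵉˣ-++ {u = _ ∷ _} halt       ()  q
≤ˡᵉˣ-++             (this p)   _   q = this p
≤ˡᵉˣ-++             (next e p) len q = next e (≤ˡᵉˣ-++ p (suc-injective len) q)

SameKernel : ∀ {A B : Set} → List (A × B) → Set
SameKernel L = ∀ {s t} → s ∈ L → t ∈ L → (proj₁ s ≡ proj₁ t ⇔ proj₂ s ≡ proj₂ t)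

zip-diagonal : ∀ {a : ℕ} pr u f → a ∈ pr → (a , a) ∈ zip (pr ++ u) (pr ++ f)
zip-diagonal (x ∷ pr) u f (here refl) = here refl
zip-diagonal (x ∷ pr) u f (there a∈) = there (zip-diagonal pr u f a∈)

zip-after : ∀ {A : Set} (pr : List A) {y x : A} u f → (y , x) ∈ zip (pr ++ y ∷ u) (pr ++ x ∷ f)
zip-after []       u f = here refl
zip-after (p ∷ pr) u f = there (zip-after pr u f)

-- The first position where f and u differ carries a letter new to the common prefix pr
-- in both words; f, being a restricted growth word, takes the smallest new letter there.
RG-lex-minimal : ∀ pr u f → IsRG (pr ++ f) → SameKernel (zip (pr ++ u) (pr ++ f)) →
  All (1 ≤_) u → length u ≡ length f → f ≤ˡᵉˣ u
RG-lex-minimal pr []      []      r k _          _   = base _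
RG-lex-minimal pr (y ∷ u) (x ∷ f) r k (1≤y ∷ pu) len with x ≟ y
... | yes refl = next refl (RG-lex-minimal (pr ++ [ x ]) u f
        (subst IsRG (sym (List.++-assoc pr [ x ] f)) r)
        (subst SameKernel (sym (cong₂ zip (List.++-assoc pr [ x ] u) (List.++-assoc pr [ x ] f))) k)
        pu (suc-injective len))
... | no x≢y = this (≤∧≢⇒< (≤-trans x≤1+max max<y) x≢y)
  where
  rg-pr : IsRG pr
  rg-pr = IsRG-++⁻ˡ pr (x ∷ f) r
  x-bounds : 1 ≤ x × x ≤ suc (maxLetter pr)
  x-bounds with RGFrom-++⁻ʳ pr (IsRG⇒RGFrom r)
  ... | cons 1≤x x≤ _ = 1≤x , x≤
  x≤1+max = proj₂ x-bounds
  new-in-prefix : ∀ {a} → 1 ≤ a → a ≤ maxLetter pr → (a , a) ∈ zip (pr ++ y ∷ u) (pr ++ x ∷ f)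
  new-in-prefix 1≤a a≤ = zip-diagonal pr (y ∷ u) (x ∷ f) (IsRG-letter∈ rg-pr 1≤a a≤)
  max<y : maxLetter pr < y
  max<y with y ≤? maxLetter pr
  ... | no  y≰ = ≰⇒> y≰
  ... | yes y≤ = ⊥-elim (x≢y (sym (Equivalence.to (k (new-in-prefix 1≤y y≤) (zip-after pr u f)) refl)))

-- Coefficients in the free algebra

module _ {c ℓ} (𝕂 : Field c ℓ) (n : ℕ) where
  module K = Field 𝕂
  open K using (Carrier; _≈_; _*_; 0#; 1#) renaming (_+_ to _+ᴷ_)
  open FreeAlgebra 𝕂 n
  open import Relation.Binary.Reasoning.Setoid K.setoid

  _≟ᴹ_ : DecidableEquality Monomial
  _≟ᴹ_ = List.≡-dec Fin._≟_

  occurrences-∷-map-same : ∀ x u xs → occurrences _≟ᴹ_ (x ∷ u) (map (_∷ u) xs) ≡ occurrences Fin._≟_ x xs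
  occurrences-∷-map-same x u []       = refl
  occurrences-∷-map-same x u (y ∷ xs) rewrite dec-true (u ≟ᴹ u) refl with does (y Fin.≟ x)
  ... | true  = cong suc (occurrences-∷-map-same x u xs)
  ... | false = occurrences-∷-map-same x u xs

  occurrences-∷-map-other : ∀ x u v xs → v ≢ u → occurrences _≟ᴹ_ (x ∷ u) (map (_∷ v) xs) ≡ 0
  occurrences-∷-map-other x u v []       _   = refl
  occurrences-∷-map-other x u v (y ∷ xs) v≢u
    rewrite dec-false (v ≟ᴹ u) v≢u | ∧-zeroʳ (does (y Fin.≟ x)) = occurrences-∷-map-other x u v xs v≢u

  occurrences-[]-map : ∀ v xs → occurrences _≟ᴹ_ [] (map (_∷ v) xs) ≡ 0
  occurrences-[]-map v []       = refl
  occurrences-[]-map v (y ∷ xs) = occurrences-[]-map v xs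

  extensions : Monomial → List Monomial
  extensions v = map (_∷ v) (allFin n)

  occurrences-extensions-[] : ∀ l → occurrences _≟ᴹ_ [] (concatMap extensions l) ≡ 0
  occurrences-extensions-[] []      = refl
  occurrences-extensions-[] (v ∷ l)
    rewrite occurrences-++ _≟ᴹ_ [] (extensions v) (concatMap extensions l) | occurrences-[]-map v (allFin n) =
    occurrences-extensions-[] l

  occurrences-extensions-∷ : ∀ x u l → occurrences _≟ᴹ_ (x ∷ u) (concatMap extensions l) ≡ occurrences _≟ᴹ_ u l
  occurrences-extensions-∷ x u []      = refl
  occurrences-extensions-∷ x u (v ∷ l)
    rewrite occurrences-++ _≟ᴹ_ (x ∷ u) (extensions v) (concatMap extensions l) | occurrences-extensions-∷ x u l with v ≟ᴹ u
  ... | yes refl rewrite occurrences-∷-map-same x v (allFin n) | occurrences-allFin n x = refl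
  ... | no v≢u   rewrite occurrences-∷-map-other x u v (allFin n) v≢u = refl

  occurrences-monomials : ∀ d u → occurrences _≟ᴹ_ u (monomials d) ≡ (if length u ≡ᵇ d then 1 else 0)
  occurrences-monomials zero    []      = refl
  occurrences-monomials zero    (x ∷ u) = refl
  occurrences-monomials (suc d) []      = occurrences-extensions-[] (monomials d)
  occurrences-monomials (suc d) (x ∷ u) = trans (occurrences-extensions-∷ x u (monomials d)) (occurrences-monomials d u)

  coeff-++ : ∀ p q u → coeff (p ++ q) u ≈ coeff p u +ᴷ coeff q u
  coeff-++ []            q u = K.sym (K.+-identityˡ _)
  coeff-++ ((a , v) ∷ p) q u with v =ᴹ u
  ... | true  = K.trans (K.+-congˡ (coeff-++ p q u)) (K.sym (K.+-assoc _ _ _))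
  ... | false = coeff-++ p q u

  coeff-· : ∀ a p u → coeff (a ·ᴾ p) u ≈ a * coeff p u
  coeff-· a []            u = K.sym (K.zeroʳ a)
  coeff-· a ((b , v) ∷ p) u with v =ᴹ u
  ... | true  = K.trans (K.+-congˡ (coeff-· a p u)) (K.sym (K.distribˡ a b _))
  ... | false = coeff-· a p u

  indicator : Bool → Carrier
  indicator b = if b then 1# else 0#

  indicator-∧ : ∀ a b → indicator a * indicator b ≈ indicator (a ∧ b)
  indicator-∧ true  b = K.*-identityˡ _
  indicator-∧ false b = K.zeroˡ _

  indicator-true : ∀ {b} → b ≡ true → indicator b ≈ 1#
  indicator-true refl = K.refl

  indicator-false : ∀ {b} → b ≢ true → indicator b ≈ 0#
  indicator-false {true}  b≢true = ⊥-elim (b≢true refl)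
  indicator-false {false} _      = K.refl

  coeff-ones : ∀ l u → coeff (map (λ z → (1# , z)) l) u ≈ ι 𝕂 (occurrences _≟ᴹ_ u l)
  coeff-ones []      u = K.refl
  coeff-ones (v ∷ l) u with v =ᴹ u
  ... | true  = K.+-congˡ (coeff-ones l u)
  ... | false = coeff-ones l u

  coeff-m : ∀ w z → coeff (m w) z ≈ indicator (sameType z w ∧ (length z ≡ᵇ length w))
  coeff-m w z = begin
    coeff (m w) z
      ≈⟨ coeff-ones (filterᵇ (λ z → sameType z w) (monomials (length w))) z ⟩
    ι 𝕂 (occurrences _≟ᴹ_ z (filterᵇ (λ z → sameType z w) (monomials (length w))))
      ≡⟨ cong (ι 𝕂) (occurrences-filterᵇ _≟ᴹ_ (λ z → sameType z w) z (monomials (length w))) ⟩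
    ι 𝕂 (if sameType z w then occurrences _≟ᴹ_ z (monomials (length w)) else 0)
      ≡⟨ cong (λ k → ι 𝕂 (if sameType z w then k else 0)) (occurrences-monomials (length w) z) ⟩
    ι 𝕂 (if sameType z w then (if length z ≡ᵇ length w then 1 else 0) else 0)
      ≈⟨ ι-indicator (sameType z w) (length z ≡ᵇ length w) ⟩
    indicator (sameType z w ∧ (length z ≡ᵇ length w)) ∎
    where
    ι-indicator : ∀ a b → ι 𝕂 (if a then (if b then 1 else 0) else 0) ≈ indicator (a ∧ b)
    ι-indicator true  true  = K.+-identityʳ 1#
    ι-indicator true  false = K.refl
    ι-indicator false b     = K.refl

  coeff-shift : ∀ a v q z → coeff (map (λ t → (a * proj₁ t , v ++ proj₂ t)) q) z ≈
    (if v =ᴹ take (length v) z then a * coeff q (drop (length v) z) else 0#)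
  coeff-shift a v q z with v =ᴹ take (length v) z in e
  ... | true  = matching q
    where
    z≡v++ : z ≡ v ++ drop (length v) z
    z≡v++ = trans (sym (List.take++drop≡id (length v) z))
                  (cong (_++ drop (length v) z) (sym (T-does⇒ (v ≟ᴹ _) (Equivalence.from T-≡ e))))
    matching : ∀ q → coeff (map (λ t → (a * proj₁ t , v ++ proj₂ t)) q) z ≈ a * coeff q (drop (length v) z)
    matching []            = K.sym (K.zeroʳ a)
    matching ((b , y) ∷ q) with (v ++ y) ≟ᴹ z | y ≟ᴹ drop (length v) z
    ... | yes _  | yes _  = K.trans (K.+-congˡ (matching q)) (K.sym (K.distribˡ a b _))
    ... | no _   | no _   = matching q
    ... | yes e₁ | no ¬e₂ = ⊥-elim (¬e₂ (trans (sym (drop-length-++ v y)) (cong (drop (length v)) e₁)))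
    ... | no ¬e₁ | yes e₂ = ⊥-elim (¬e₁ (trans (cong (v ++_) e₂) (sym z≡v++)))
  ... | false = mismatching q
    where
    mismatching : ∀ q → coeff (map (λ t → (a * proj₁ t , v ++ proj₂ t)) q) z ≈ 0#
    mismatching []            = K.refl
    mismatching ((b , y) ∷ q) with (v ++ y) ≟ᴹ z
    ... | yes e₁
      with () ← trans (sym e) (dec-true (v ≟ᴹ _) (trans (sym (take-length-++ v y)) (cong (take (length v)) e₁)))
    ... | no _  = mismatching q

  Homogeneous : ℕ → Poly → Set c
  Homogeneous d p = All (λ t → length (proj₂ t) ≡ d) p

  coeff-*ᴾ : ∀ d p q z → Homogeneous d p → coeff (p *ᴾ q) z ≈ coeff p (take d z) * coeff q (drop d z)
  coeff-*ᴾ d []            q z _            = K.sym (K.zeroˡ _)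
  coeff-*ᴾ d ((a , v) ∷ p) q z (refl ∷ hom) = begin
    coeff (map (λ t → (a * proj₁ t , v ++ proj₂ t)) q ++ (p *ᴾ q)) z
      ≈⟨ coeff-++ (map (λ t → (a * proj₁ t , v ++ proj₂ t)) q) (p *ᴾ q) z ⟩
    coeff (map (λ t → (a * proj₁ t , v ++ proj₂ t)) q) z +ᴷ coeff (p *ᴾ q) z
      ≈⟨ K.+-cong (coeff-shift a v q z) (coeff-*ᴾ (length v) p q z hom) ⟩
    (if v =ᴹ take (length v) z then a * coeff q rest else 0#) +ᴷ coeff p (take (length v) z) * coeff q rest
      ≈⟨ collect (v =ᴹ take (length v) z) ⟩
    coeff ((a , v) ∷ p) (take (length v) z) * coeff q rest ∎
    where
    rest = drop (length v) z
    collect : ∀ b → (if b then a * coeff q rest else 0#) +ᴷ coeff p (take (length v) z) * coeff q rest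
      ≈ (if b then a +ᴷ coeff p (take (length v) z) else coeff p (take (length v) z)) * coeff q rest
    collect true  = K.sym (K.distribʳ _ a _)
    collect false = K.+-identityˡ _

  length-monomials : ∀ d → All (λ u → length u ≡ d) (monomials d)
  length-monomials zero    = refl ∷ []
  length-monomials (suc d) =
    All.concat⁺ (All.map⁺ (All.map (λ len-v → All.map⁺ (All.universal (λ _ → cong suc len-v) (allFin n)))
                                   (length-monomials d)))

  m-homogeneous : ∀ w → Homogeneous (length w) (m w)
  m-homogeneous w = All.map⁺ (All.filter⁺ (T? ∘ λ z → sameType z w) (length-monomials (length w)))

  -- The support of m_{f₁} ⋯ m_{f_k}: z cuts into consecutive pieces of types f₁, …, f_k.
  hasSegmentTypes : List Word → Monomial → Bool
  hasSegmentTypes []       z = null z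
  hasSegmentTypes (f ∷ fs) z =
    (sameType (take (length f) z) f ∧ (length (take (length f) z) ≡ᵇ length f)) ∧ hasSegmentTypes fs (drop (length f) z)

  coeff-product-m : ∀ fs z → coeff (productᴾ (map m fs)) z ≈ indicator (hasSegmentTypes fs z)
  coeff-product-m []       []      = K.+-identityʳ 1#
  coeff-product-m []       (x ∷ z) = K.refl
  coeff-product-m (f ∷ fs) z =
    K.trans (coeff-*ᴾ (length f) (m f) (productᴾ (map m fs)) z (m-homogeneous f))
      (K.trans (K.*-cong (coeff-m f (take (length f) z)) (coeff-product-m fs (drop (length f) z))) (indicator-∧ _ _))

  sameType⇒SameKernel : ∀ z w → sameType z w ≡ true → SameKernel (zip z w)
  sameType⇒SameKernel z w e {a , b} {a′ , b′} s∈ t∈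
    with All.lookup (All.all⁺ _ (zip z w) (All.lookup (All.all⁺ _ (zip z w) (Equivalence.from T-≡ e)) s∈)) t∈
  ... | entry with a Fin.≟ a′
  ...   | yes a≡a′ = mk⇔ (λ _ → ≡ᵇ⇒≡ b b′ entry) (λ _ → a≡a′)
  ...   | no  a≢a′ = mk⇔ (λ a≡a′ → ⊥-elim (a≢a′ a≡a′)) (λ { refl → ⊥-elim (T-not-≡ᵇ-refl b entry) })
    where
    T-not-≡ᵇ-refl : ∀ k → T (not (k ≡ᵇ k)) → ⊥
    T-not-≡ᵇ-refl (suc k) t = T-not-≡ᵇ-refl k t

  SameKernel⇒sameType : ∀ z w → SameKernel (zip z w) → sameType z w ≡ true
  SameKernel⇒sameType z w k with T? (sameType z w)
  ... | yes t = Equivalence.to T-≡ t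
  ... | no ¬t with find (All.¬All⇒Any¬ (T? ∘ _) (zip z w) (¬t ∘ All.all⁻ _))
  ...   | s , s∈ , ¬ts with find (All.¬All⇒Any¬ (T? ∘ _) (zip z w) (¬ts ∘ All.all⁻ _))
  ...     | t , t∈ , ¬entry with proj₁ s Fin.≟ proj₁ t
  ...       | yes a≡a′ = ⊥-elim (¬entry (≡⇒≡ᵇ (proj₂ s) (proj₂ t) (Equivalence.to (k s∈ t∈) a≡a′)))
  ...       | no  a≢a′ with proj₂ s ≡ᵇ proj₂ t in eq
  ...         | true  = ⊥-elim (a≢a′ (Equivalence.from (k s∈ t∈) (≡ᵇ⇒≡ (proj₂ s) (proj₂ t) (Equivalence.from T-≡ eq))))
  ...         | false = ⊥-elim (¬entry _)

  label : Fin n → ℕ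
  label i = suc (Fin.toℕ i)

  label-injective : ∀ {i j} → label i ≡ label j → i ≡ j
  label-injective e = Fin.toℕ-injective (suc-injective e)

  labels : Monomial → Word
  labels = map label

  zip-labels : ∀ z (v : Word) → zip (labels z) v ≡ map (Product.map label id) (zip z v)
  zip-labels z v = trans (cong (zip (labels z)) (sym (List.map-id v))) (List.zip-map label id z v)

  SameKernel-labels : ∀ z (v : Word) → SameKernel (zip z v) → SameKernel (zip (labels z) v)
  SameKernel-labels z v k {s} {t} s∈ t∈
    with ∈-map⁻ _ (subst (s ∈_) (zip-labels z v) s∈) | ∈-map⁻ _ (subst (t ∈_) (zip-labels z v) t∈)
  ... | _ , s′∈ , refl | _ , t′∈ , refl =
    mk⇔ (λ e → Equivalence.to (k s′∈ t′∈) (label-injective e)) (λ e → cong label (Equivalence.from (k s′∈ t′∈) e))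

  sameType⇒≤ˡᵉˣ : ∀ z v → sameType z v ≡ true → length z ≡ length v → IsRG v → v ≤ˡᵉˣ labels z
  sameType⇒≤ˡᵉˣ z v st len r =
    RG-lex-minimal [] (labels z) v r (SameKernel-labels z v (sameType⇒SameKernel z v st))
      (All.map⁺ (All.universal (λ _ → s≤s z≤n) z)) (trans (List.length-map label z) len)

  hasSegmentTypes⇒≤ˡᵉˣ : ∀ fs z → hasSegmentTypes fs z ≡ true → All IsRG fs → concat fs ≤ˡᵉˣ labels z
  hasSegmentTypes⇒≤ˡᵉˣ []       []      _ _          = base _
  hasSegmentTypes⇒≤ˡᵉˣ (f ∷ fs) z       e (rf ∷ rfs) with ∧-true⁻ _ e
  ... | piece , rest with ∧-true⁻ (sameType (take (length f) z) f) piece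
  ...   | st , len-piece =
    subst (f ++ concat fs ≤ˡᵉˣ_)
      (trans (sym (List.map-++ label (take (length f) z) _)) (cong labels (List.take++drop≡id (length f) z)))
      (≤ˡᵉˣ-++ (sameType⇒≤ˡᵉˣ (take (length f) z) f st len rf)
               (sym (trans (List.length-map label (take (length f) z)) len))
               (hasSegmentTypes⇒≤ˡᵉˣ fs (drop (length f) z) rest rfs))
    where
    len : length (take (length f) z) ≡ length f
    len = ≡ᵇ⇒≡ _ _ (Equivalence.from T-≡ len-piece)

  zip-∈ : ∀ {j : ℕ} (z : Monomial) v → j ∈ v → length z ≡ length v → Σ (Fin n) λ a → (a , j) ∈ zip z v
  zip-∈ (a ∷ z) (x ∷ v) (here refl) _   = a , here refl
  zip-∈ (a ∷ z) (x ∷ v) (there j∈)  len with zip-∈ z v j∈ (suc-injective len)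
  ... | b , b∈ = b , there b∈

  block-variable : ∀ z v → length z ≡ length v → IsRG v → (i : Fin (maxLetter v)) →
    Σ (Fin n) λ a → (a , suc (Fin.toℕ i)) ∈ zip z v
  block-variable z v len r i = zip-∈ z v (IsRG-letter∈ r (s≤s z≤n) (Fin.toℕ<n i)) len

  -- Distinct blocks of the type of z carry distinct variables, so there are at most n of them.
  sameType⇒maxLetter≤n : ∀ z v → sameType z v ≡ true → length z ≡ length v → IsRG v → maxLetter v ≤ n
  sameType⇒maxLetter≤n z v st len r with maxLetter v ≤? n
  ... | yes le = le
  ... | no  nle with Fin.pigeonhole (≰⇒> nle) (proj₁ ∘ block-variable z v len r)
  ...   | i , j , i<j , same = ⊥-elim (<⇒≢ i<j (suc-injective (Equivalence.to
            (sameType⇒SameKernel z v st (proj₂ (block-variable z v len r i)) (proj₂ (block-variable z v len r j)))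
            same)))

  m-vanishes : ∀ v → IsRG v → ¬ maxLetter v ≤ n → m v ≈ᴾ 0ᴾ
  m-vanishes v r nle z = K.trans (coeff-m v z) (indicator-false λ e →
    let st , len = ∧-true⁻ (sameType z v) e
    in nle (sameType⇒maxLetter≤n z v st (≡ᵇ⇒≡ _ _ (Equivalence.from T-≡ len)) r))

  product-m-vanishes : ∀ vs → Any (λ v → m v ≈ᴾ 0ᴾ) vs → productᴾ (map m vs) ≈ᴾ 0ᴾ
  product-m-vanishes (v ∷ vs) (here  m≈0) u =
    K.trans (coeff-*ᴾ (length v) (m v) _ u (m-homogeneous v)) (K.trans (K.*-congʳ (m≈0 _)) (K.zeroˡ _))
  product-m-vanishes (v ∷ vs) (there any) u =
    K.trans (coeff-*ᴾ (length v) (m v) _ u (m-homogeneous v))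
      (K.trans (K.*-congˡ (product-m-vanishes vs any _)) (K.zeroʳ _))

  -- Linear combinations and unitriangular families

  module _ {I : Set} (b : I → Poly) where

    Σcoeff : List (Carrier × I) → Monomial → Carrier
    Σcoeff []       u = 0#
    Σcoeff (t ∷ ts) u = proj₁ t * coeff (b (proj₂ t)) u +ᴷ Σcoeff ts u

    coeff-linComb : ∀ ts u → coeff (linComb b ts) u ≈ Σcoeff ts u
    coeff-linComb []       u = K.refl
    coeff-linComb (t ∷ ts) u = K.trans (coeff-++ (proj₁ t ·ᴾ b (proj₂ t)) (linComb b ts) u)
                                       (K.+-cong (coeff-· (proj₁ t) (b (proj₂ t)) u) (coeff-linComb ts u))

    Σcoeff-vanishing : ∀ ts u → All (λ t → coeff (b (proj₂ t)) u ≈ 0#) ts → Σcoeff ts u ≈ 0#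
    Σcoeff-vanishing []       u []       = K.refl
    Σcoeff-vanishing (t ∷ ts) u (z ∷ zs) =
      K.trans (K.+-cong (K.trans (K.*-congˡ z) (K.zeroʳ _)) (Σcoeff-vanishing ts u zs)) (K.+-identityˡ 0#)

    Σcoeff-extract : ∀ xs t ys u → Σcoeff (xs ++ t ∷ ys) u ≈ proj₁ t * coeff (b (proj₂ t)) u +ᴷ Σcoeff (xs ++ ys) u
    Σcoeff-extract []       t ys u = K.refl
    Σcoeff-extract (s ∷ xs) t ys u = K.trans (K.+-congˡ (Σcoeff-extract xs t ys u))
      (K.trans (K.sym (K.+-assoc _ _ _)) (K.trans (K.+-congʳ (K.+-comm _ _)) (K.+-assoc _ _ _)))

    linComb-extract-zero : ∀ xs t ys → proj₁ t ≈ 0# → linComb b (xs ++ t ∷ ys) ≈ᴾ 0ᴾ → linComb b (xs ++ ys) ≈ᴾ 0ᴾ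
    linComb-extract-zero xs t ys t≈0 lin≈0 u = begin
      coeff (linComb b (xs ++ ys)) u                          ≈⟨ coeff-linComb (xs ++ ys) u ⟩
      Σcoeff (xs ++ ys) u                                     ≈⟨ K.sym (K.+-identityˡ _) ⟩
      0# +ᴷ Σcoeff (xs ++ ys) u
        ≈⟨ K.+-congʳ (K.sym (K.trans (K.*-congʳ t≈0) (K.zeroˡ _))) ⟩
      proj₁ t * coeff (b (proj₂ t)) u +ᴷ Σcoeff (xs ++ ys) u  ≈⟨ K.sym (Σcoeff-extract xs t ys u) ⟩
      Σcoeff (xs ++ t ∷ ys) u                                 ≈⟨ K.sym (coeff-linComb (xs ++ t ∷ ys) u) ⟩
      coeff (linComb b (xs ++ t ∷ ys)) u                      ≈⟨ lin≈0 u ⟩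
      0#                                                      ∎

  InSpan-generator : ∀ {I : Set} (P : I → Set) (b : I → Poly) i → P i → InSpan P b (b i)
  InSpan-generator P b i p = ((1# , i) ∷ []) , (p ∷ []) , λ u →
    K.trans (coeff-linComb b ((1# , i) ∷ []) u) (K.trans (K.+-identityʳ _) (K.*-identityˡ _))

  InSpan-transfer : ∀ {I J : Set} (P : I → Set) (Q : J → Set) (b : I → Poly) (b′ : J → Poly) →
    (∀ i → P i → (b i ≈ᴾ 0ᴾ) ⊎ Σ J (λ j → Q j × (b′ j ≈ᴾ b i))) → ∀ x → InSpan P b x → InSpan Q b′ x
  InSpan-transfer {I} {J} P Q b b′ replace x (ts , pts , ts≈x) =
    let ts′ , qts′ , same = rewrite-terms ts pts in
    ts′ , qts′ , λ u →
      K.trans (coeff-linComb b′ ts′ u) (K.trans (same u) (K.trans (K.sym (coeff-linComb b ts u)) (ts≈x u)))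
    where
    rewrite-terms : ∀ ts → All (λ t → P (proj₂ t)) ts →
      Σ (List (Carrier × J)) λ ts′ → All (λ t → Q (proj₂ t)) ts′ × (∀ u → Σcoeff b′ ts′ u ≈ Σcoeff b ts u)
    rewrite-terms []             []       = [] , [] , λ u → K.refl
    rewrite-terms ((a , i) ∷ ts) (p ∷ ps) with rewrite-terms ts ps | replace i p
    ... | ts′ , qs , same | inj₁ bi≈0 =
      ts′ , qs , λ u →
        K.trans (same u) (K.sym (K.trans (K.+-congʳ (K.trans (K.*-congˡ (bi≈0 u)) (K.zeroʳ a))) (K.+-identityˡ _)))
    ... | ts′ , qs , same | inj₂ (j , q , b′j≈bi) =
      (a , j) ∷ ts′ , q ∷ qs , λ u → K.+-cong (K.*-congˡ (b′j≈bi u)) (same u)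

  -- In a vanishing combination, the coefficient of the term with the least key is read off at
  -- its witness, so it is 0; remove that term and repeat.
  module Unitriangular {I : Set} (P : I → Set) (b : I → Poly) (key : I → Word) (witness : I → Monomial)
    (diagonal : ∀ i → P i → coeff (b i) (witness i) ≈ 1#)
    (triangular : ∀ i j → P i → P j → ¬ key j ≤ˡᵉˣ key i → coeff (b j) (witness i) ≈ 0#)
    (key-injective : ∀ i j → P i → P j → key i ≡ key j → i ≡ j) where

    Least : List (Carrier × I) → Carrier × I → Set c
    Least ts t₀ = All (λ t → key (proj₂ t₀) ≤ˡᵉˣ key (proj₂ t)) ts

    least : ∀ t ts → Σ (Carrier × I) λ t₀ → t₀ ∈ t ∷ ts × Least (t ∷ ts) t₀
    least t []        = t , here refl , ≤ˡᵉˣ.refl ∷ []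
    least t (t′ ∷ ts) with least t′ ts
    ... | t₀ , t₀∈ , t₀-least with ≤ˡᵉˣ.total (key (proj₂ t)) (key (proj₂ t₀))
    ...   | inj₁ t≤t₀ = t , here refl , ≤ˡᵉˣ.refl ∷ All.map (≤ˡᵉˣ.trans t≤t₀) t₀-least
    ...   | inj₂ t₀≤t = t₀ , there t₀∈ , t₀≤t ∷ t₀-least

    least-coefficient-vanishes : ∀ ts₁ t₀ ts₂ → P (proj₂ t₀) → All (λ t → P (proj₂ t)) (ts₁ ++ ts₂) →
      All (λ t → proj₂ t ≢ proj₂ t₀) (ts₁ ++ ts₂) → Least (ts₁ ++ ts₂) t₀ → linComb b (ts₁ ++ t₀ ∷ ts₂) ≈ᴾ 0ᴾ →
      proj₁ t₀ ≈ 0#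
    least-coefficient-vanishes ts₁ (c₀ , i₀) ts₂ p₀ pts distinct t₀-least lin≈0 = begin
      c₀                                    ≈⟨ K.sym (K.*-identityʳ c₀) ⟩
      c₀ * 1#                               ≈⟨ K.*-congˡ (K.sym (diagonal i₀ p₀)) ⟩
      c₀ * coeff (b i₀) (witness i₀)        ≈⟨ K.sym (K.+-identityʳ _) ⟩
      c₀ * coeff (b i₀) (witness i₀) +ᴷ 0#  ≈⟨ K.+-congˡ (K.sym (Σcoeff-vanishing b _ _ others-vanish)) ⟩
      c₀ * coeff (b i₀) (witness i₀) +ᴷ Σcoeff b (ts₁ ++ ts₂) (witness i₀)
        ≈⟨ K.sym (Σcoeff-extract b ts₁ (c₀ , i₀) ts₂ _) ⟩
      Σcoeff b (ts₁ ++ (c₀ , i₀) ∷ ts₂) (witness i₀)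
        ≈⟨ K.sym (coeff-linComb b (ts₁ ++ (c₀ , i₀) ∷ ts₂) (witness i₀)) ⟩
      coeff (linComb b (ts₁ ++ (c₀ , i₀) ∷ ts₂)) (witness i₀)
        ≈⟨ lin≈0 (witness i₀) ⟩
      0# ∎
      where
      vanish : ∀ (t : Carrier × I) → proj₂ t ≢ i₀ → P (proj₂ t) → key i₀ ≤ˡᵉˣ key (proj₂ t) →
        coeff (b (proj₂ t)) (witness i₀) ≈ 0#
      vanish t t≢i₀ pt i₀≤t with key (proj₂ t) ≤ˡᵉˣ.≤? key i₀
      ... | yes t≤i₀ = ⊥-elim (t≢i₀ (key-injective _ _ pt p₀ (Pointwise-≡⇒≡ (≤ˡᵉˣ.antisym t≤i₀ i₀≤t))))
      ... | no  t≰i₀ = triangular i₀ (proj₂ t) p₀ pt t≰i₀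
      others-vanish : All (λ t → coeff (b (proj₂ t)) (witness i₀) ≈ 0#) (ts₁ ++ ts₂)
      others-vanish = All.zipWith (λ {t} (t≢ , pt , i₀≤t) → vanish t t≢ pt i₀≤t) (distinct , All.zip (pts , t₀-least))

    linIndep : LinIndep P b
    linIndep ts = bounded (length ts) ts ≤-refl
      where
      bounded : ∀ k ts → length ts ≤ k → Unique (map proj₂ ts) → All (λ t → P (proj₂ t)) ts →
        linComb b ts ≈ᴾ 0ᴾ → All (λ t → proj₁ t ≈ 0#) ts
      bounded k       []       _  _    _   _     = []
      bounded (suc k) (t ∷ ts) le uniq pts lin≈0 with least t ts
      ... | t₀ , t₀∈ , t₀-least with ∈-∃++ t₀∈
      ...   | ts₁ , ts₂ , split
        with Unique-map-extract proj₂ ts₁ (subst (λ l → Unique (map proj₂ l)) split uniq)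
           | All-extract ts₁ (subst (All (λ t → P (proj₂ t))) split pts)
      ...     | uniq-rest , distinct | pts-rest , p₀ =
        subst (All (λ t → proj₁ t ≈ 0#)) (sym split) (All-insert ts₁ rest-vanish c₀≈0)
        where
        lin≈0′ = subst (λ l → linComb b l ≈ᴾ 0ᴾ) split lin≈0
        c₀≈0 : proj₁ t₀ ≈ 0#
        c₀≈0 = least-coefficient-vanishes ts₁ t₀ ts₂ p₀ pts-rest distinct
                 (proj₁ (All-extract ts₁ (subst (λ l → Least l t₀) split t₀-least))) lin≈0′
        shorter : length (ts₁ ++ ts₂) ≤ k
        shorter = ≤-pred (subst (_≤ suc k) (trans (cong length split) (length-extract ts₁ t₀ ts₂)) le)
        rest-vanish : All (λ t → proj₁ t ≈ 0#) (ts₁ ++ ts₂)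
        rest-vanish = bounded k (ts₁ ++ ts₂) shorter uniq-rest pts-rest (linComb-extract-zero b ts₁ t₀ ts₂ c₀≈0 lin≈0′)

  -- The bases of 𝒞 and 𝒩

  InRange : Word → Set
  InRange w = All (λ x → 1 ≤ x × x ≤ n) w

  ∈⇒≤maxLetter : ∀ {x} w → x ∈ w → x ≤ maxLetter w
  ∈⇒≤maxLetter (y ∷ w) (here refl) = m≤m⊔n y (maxLetter w)
  ∈⇒≤maxLetter (y ∷ w) (there x∈)  = ≤-trans (∈⇒≤maxLetter w x∈) (m≤n⊔m y (maxLetter w))

  IsRG⇒InRange : ∀ w → IsRG w → maxLetter w ≤ n → InRange w
  IsRG⇒InRange w r le =
    All.tabulate λ x∈ → All.lookup (RGFrom-positive (IsRG⇒RGFrom r)) x∈ , ≤-trans (∈⇒≤maxLetter w x∈) le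

  module _ (n≥1 : 1 ≤ n) where

    letter : ℕ → Fin n
    letter x with pred x <? n
    ... | yes x≤n = Fin.fromℕ< x≤n
    ... | no  _   = Fin.fromℕ< n≥1

    label-letter : ∀ x → 1 ≤ x → x ≤ n → label (letter x) ≡ x
    label-letter (suc x) _ x<n with x <? n
    ... | yes x<n′ = cong suc (Fin.toℕ-fromℕ< x<n′)
    ... | no  x≮n  = ⊥-elim (x≮n x<n)

    -- x_{w₁} ⋯ x_{w_d}, whose type is w when w is a restricted growth word with letters ≤ n.
    canonical : Word → Monomial
    canonical = map letter

    labels-canonical : ∀ w → InRange w → labels (canonical w) ≡ w
    labels-canonical []      _                  = refl
    labels-canonical (x ∷ w) ((1≤x , x≤n) ∷ rs) = cong₂ _∷_ (label-letter x 1≤x x≤n) (labels-canonical w rs)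

    label-letter-∈ : ∀ {x} w → InRange w → x ∈ w → label (letter x) ≡ x
    label-letter-∈ w rs x∈ = let 1≤x , x≤n = All.lookup rs x∈ in label-letter _ 1≤x x≤n

    zip-canonical : ∀ w → zip (canonical w) w ≡ map (λ x → letter x , x) w
    zip-canonical []      = refl
    zip-canonical (x ∷ w) = cong (_ ∷_) (zip-canonical w)

    SameKernel-canonical : ∀ w → InRange w → SameKernel (zip (canonical w) w)
    SameKernel-canonical w rs {s} {t} s∈ t∈
      with ∈-map⁻ _ (subst (s ∈_) (zip-canonical w) s∈) | ∈-map⁻ _ (subst (t ∈_) (zip-canonical w) t∈)
    ... | x , x∈ , refl | y , y∈ , refl = mk⇔
      (λ e → trans (sym (label-letter-∈ w rs x∈)) (trans (cong label e) (label-letter-∈ w rs y∈)))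
      (cong letter)

    canonical-sameType : ∀ w → InRange w → sameType (canonical w) w ≡ true
    canonical-sameType w rs = SameKernel⇒sameType (canonical w) w (SameKernel-canonical w rs)

    coeff-m-canonical : ∀ w → InRange w → coeff (m w) (canonical w) ≈ 1#
    coeff-m-canonical w rs = K.trans (coeff-m w (canonical w))
      (indicator-true (∧-true⁺ (canonical-sameType w rs) (≡ᵇ-true (List.length-map letter w))))

    coeff-m-canonical-vanishes : ∀ v w → IsRG v → InRange w → ¬ v ≤ˡᵉˣ w → coeff (m v) (canonical w) ≈ 0#
    coeff-m-canonical-vanishes v w r rs v≰w = K.trans (coeff-m v (canonical w)) (indicator-false λ e →
      let st , len = ∧-true⁻ (sameType (canonical w) v) e in
      v≰w (subst (v ≤ˡᵉˣ_) (labels-canonical w rs)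
                 (sameType⇒≤ˡᵉˣ (canonical w) v st (≡ᵇ⇒≡ _ _ (Equivalence.from T-≡ len)) r)))

    hasSegmentTypes-canonical : ∀ fs → InRange (concat fs) → hasSegmentTypes fs (canonical (concat fs)) ≡ true
    hasSegmentTypes-canonical []       _  = refl
    hasSegmentTypes-canonical (f ∷ fs) rs
      rewrite List.map-++ letter f (concat fs)
            | take-map-++ letter f (canonical (concat fs)) | drop-map-++ letter f (canonical (concat fs))
            | canonical-sameType f (All.++⁻ˡ f rs) | List.length-map letter f | ≡ᵇ-true {length f} refl =
      hasSegmentTypes-canonical fs (All.++⁻ʳ f rs)

    coeff-product-m-canonical : ∀ fs → InRange (concat fs) → coeff (productᴾ (map m fs)) (canonical (concat fs)) ≈ 1#
    coeff-product-m-canonical fs rs =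
      K.trans (coeff-product-m fs (canonical (concat fs))) (indicator-true (hasSegmentTypes-canonical fs rs))

    coeff-product-m-canonical-vanishes : ∀ fs w → All IsRG fs → InRange w → ¬ concat fs ≤ˡᵉˣ w →
      coeff (productᴾ (map m fs)) (canonical w) ≈ 0#
    coeff-product-m-canonical-vanishes fs w rfs rs fs≰w =
      K.trans (coeff-product-m fs (canonical w)) (indicator-false λ e →
      fs≰w (subst (concat fs ≤ˡᵉˣ_) (labels-canonical w rs) (hasSegmentTypes⇒≤ˡᵉˣ fs (canonical w) e rfs)))

    CIndex⇒InRange : ∀ {w} → CIndex w → InRange w
    CIndex⇒InRange {w} (r , le , _) = IsRG⇒InRange w r le

    cBasis-in-C : ∀ w → CIndex w → InC (cBasis w)
    cBasis-in-C w (r , _ , _) =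
      InSpan-generator (All IsBimodal) (λ vs → productᴾ (map m vs)) (bimodalFactors w) (bimodalFactors-bimodal w r)

    cBasis-canonical : ∀ w → CIndex w → coeff (cBasis w) (canonical w) ≈ 1#
    cBasis-canonical w ci@(_ , _ , tf) = subst (λ k → coeff (cBasis w) (canonical k) ≈ 1#) (concat-bimodalFactors w tf)
      (coeff-product-m-canonical (bimodalFactors w)
        (subst InRange (sym (concat-bimodalFactors w tf)) (CIndex⇒InRange ci)))

    cBasis-triangular : ∀ i j → CIndex i → CIndex j → ¬ j ≤ˡᵉˣ i → coeff (cBasis j) (canonical i) ≈ 0#
    cBasis-triangular i j ci (r , _ , tf) j≰i =
      coeff-product-m-canonical-vanishes (bimodalFactors j) i
        (All.map proj₁ (bimodalFactors-bimodal j r)) (CIndex⇒InRange ci)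
        (subst (λ k → ¬ k ≤ˡᵉˣ i) (sym (concat-bimodalFactors j tf)) j≰i)

    maxLetter-concat≤ : ∀ vs → All (λ v → maxLetter v ≤ n) vs → maxLetter (concat vs) ≤ n
    maxLetter-concat≤ []       []       = z≤n
    maxLetter-concat≤ (v ∷ vs) (p ∷ ps) =
      subst (_≤ n) (sym (maxLetter-++ v (concat vs))) (⊔-lub p (maxLetter-concat≤ vs ps))

    some-m-vanishes : ∀ vs → All IsRG vs → Any (λ v → ¬ maxLetter v ≤ n) vs → Any (λ v → m v ≈ᴾ 0ᴾ) vs
    some-m-vanishes (v ∷ _)  (r ∷ _)  (here large) = here (m-vanishes v r large)
    some-m-vanishes (_ ∷ vs) (_ ∷ rs) (there any)  = there (some-m-vanishes vs rs any)

    product-m-bimodal-zero-or-cBasis : ∀ vs → All IsBimodal vs →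
      (productᴾ (map m vs) ≈ᴾ 0ᴾ) ⊎ Σ Word (λ w → CIndex w × (cBasis w ≈ᴾ productᴾ (map m vs)))
    product-m-bimodal-zero-or-cBasis vs bs with All.all? (λ v → maxLetter v ≤? n) vs
    ... | no  some-large = inj₁ (product-m-vanishes vs
      (some-m-vanishes vs (All.map proj₁ bs) (All.¬All⇒Any¬ (λ v → maxLetter v ≤? n) vs some-large)))
    ... | yes small      = inj₂
      (concat vs , (IsRG-concat⁺ vs (All.map proj₁ bs) , maxLetter-concat≤ vs small , cong proj₂ dec) ,
       λ u → K.reflexive (cong (λ fs → coeff (productᴾ (map m fs)) u) (cong proj₁ dec)))
      where dec = bimodalDecomposition-concat vs bs

    C-basis : IsBasisOf InC CIndex cBasis
    C-basis =
      cBasis-in-C ,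
      Unitriangular.linIndep CIndex cBasis id canonical cBasis-canonical cBasis-triangular (λ _ _ _ _ i≡j → i≡j) ,
      InSpan-transfer (All IsBimodal) CIndex (λ vs → productᴾ (map m vs)) cBasis product-m-bimodal-zero-or-cBasis

    φIndex : Word × List ℕ → Set
    φIndex p = CIndex (proj₁ p) × LIndex (proj₂ p)

    φWord : Word × List ℕ → Word
    φWord (w , μ) = concat (bimodalFactors w) ++ wordOf μ

    φWord-tailFree : ∀ w μ → IsTailFree w → φWord (w , μ) ≡ w ++ wordOf μ
    φWord-tailFree w μ tf = cong (_++ wordOf μ) (concat-bimodalFactors w tf)

    φWord-IsRG : ∀ p → φIndex p → IsRG (φWord p)
    φWord-IsRG (w , μ) ((r , _ , tf) , pμ , _) = subst IsRG (sym (φWord-tailFree w μ tf))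
      (IsRG-++⁺ w (wordOf μ) r (IsRG-wordOf μ (proj₁ (isPartition⇒Partition μ pμ))))

    φWord-InRange : ∀ p → φIndex p → InRange (φWord p)
    φWord-InRange (w , μ) pi@((_ , le , tf) , pμ , len) = IsRG⇒InRange _ (φWord-IsRG (w , μ) pi)
      (subst (λ k → maxLetter k ≤ n) (sym (φWord-tailFree w μ tf))
        (subst (_≤ n) (sym (maxLetter-++ w (wordOf μ)))
          (⊔-lub le (subst (_≤ n) (sym (maxLetter-wordOf (proj₁ (isPartition⇒Partition μ pμ)))) len))))

    φWord-injective : ∀ p q → φIndex p → φIndex q → φWord p ≡ φWord q → p ≡ q
    φWord-injective (w , μ) (w′ , μ′) ((r , _ , tf) , pμ , _) ((r′ , _ , tf′) , pμ′ , _) e =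
      cong₂ _,_
        (trans (sym (concat-bimodalFactors w tf))
               (trans (cong (concat ∘ proj₁) decompositions) (concat-bimodalFactors w′ tf′)))
        (wordOfFrom-injective 0 μ μ′ (proj₁ (isPartition⇒Partition μ pμ)) (proj₁ (isPartition⇒Partition μ′ pμ′))
                              (cong proj₂ decompositions))
      where
      decompose : ∀ w μ → IsRG w → IsTailFree w → isPartition μ ≡ true →
        bimodalDecomposition (φWord (w , μ)) ≡ (bimodalFactors w , wordOf μ)
      decompose w μ r tf pμ = trans (cong bimodalDecomposition (φWord-tailFree w μ tf))
        (bimodalDecomposition-++-wordOf w μ r tf (isPartition⇒Partition μ pμ))
      decompositions : (bimodalFactors w , wordOf μ) ≡ (bimodalFactors w′ , wordOf μ′)
      decompositions =
        trans (sym (decompose w μ r tf pμ)) (trans (cong bimodalDecomposition e) (decompose w′ μ′ r′ tf′ pμ′))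

    φBasis-canonical : ∀ p → φIndex p → coeff (φBasis p) (canonical (φWord p)) ≈ 1#
    φBasis-canonical p pi = coeff-m-canonical (φWord p) (φWord-InRange p pi)

    φBasis-triangular : ∀ p q → φIndex p → φIndex q → ¬ φWord q ≤ˡᵉˣ φWord p →
      coeff (φBasis q) (canonical (φWord p)) ≈ 0#
    φBasis-triangular p q pi qi = coeff-m-canonical-vanishes (φWord q) (φWord p) (φWord-IsRG q qi) (φWord-InRange p pi)

    maxLetter-++-≤⁻ : ∀ u v → maxLetter (u ++ v) ≤ n → maxLetter u ≤ n × maxLetter v ≤ n
    maxLetter-++-≤⁻ u v le = let le′ = subst (_≤ n) (maxLetter-++ u v) le in
      ≤-trans (m≤m⊔n _ _) le′ , ≤-trans (m≤n⊔m _ _) le′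

    m-zero-or-φBasis : ∀ v → IsRG v → (m v ≈ᴾ 0ᴾ) ⊎ Σ (Word × List ℕ) (λ p → φIndex p × (φBasis p ≈ᴾ m v))
    m-zero-or-φBasis v r with maxLetter v ≤? n
    ... | no  large = inj₁ (m-vanishes v r large)
    ... | yes small with isConvex⇒wordOf (bimodalTail v) (bimodalTail-isConvex v)
    ...   | μ , pμ , wordOf-μ =
      inj₂ ((w , μ) , ((IsRG-++⁻ˡ w (bimodalTail v) (subst IsRG (sym split) r) , proj₁ small-parts , tail-free) ,
                       (Partition⇒isPartition pμ , length-μ≤n)) ,
            λ u → K.reflexive (cong (λ k → coeff (m k) u) φWord≡v))
      where
      w = concat (bimodalFactors v)
      split : w ++ bimodalTail v ≡ v
      split = concat-bimodalDecomposition v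
      small-parts = maxLetter-++-≤⁻ w (bimodalTail v) (subst (λ k → maxLetter k ≤ n) (sym split) small)
      length-μ≤n : length μ ≤ n
      length-μ≤n =
        subst (_≤ n) (trans (cong maxLetter (sym wordOf-μ)) (maxLetter-wordOf (proj₁ pμ))) (proj₂ small-parts)
      factors : bimodalDecomposition w ≡ (bimodalFactors v , [])
      factors = bimodalDecomposition-concat (bimodalFactors v) (bimodalFactors-bimodal v r)
      tail-free : IsTailFree w
      tail-free = cong proj₂ factors
      φWord≡v : φWord (w , μ) ≡ v
      φWord≡v = trans (cong₂ (λ fs t → concat fs ++ t) (cong proj₁ factors) wordOf-μ) split

    φ-basis : IsBasisOf InN φIndex φBasis
    φ-basis =
      (λ p pi → InSpan-generator IsRG m (φWord p) (φWord-IsRG p pi)) ,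
      Unitriangular.linIndep φIndex φBasis φWord (canonical ∘ φWord)
        φBasis-canonical φBasis-triangular φWord-injective ,
      InSpan-transfer IsRG φIndex m φBasis m-zero-or-φBasis

theorem6p1 : ∀ {c ℓ} (𝕂 : Field c ℓ) → CharZero 𝕂 → (n : ℕ) → 1 ≤ n →
    -- 𝒞 has basis { m_{w′} ⋯ m_{w⁽ʳ⁾} : w RG word, letters ≤ n, tail-free }
    FreeAlgebra.IsBasisOf 𝕂 n (FreeAlgebra.InC 𝕂 n)
      (FreeAlgebra.CIndex 𝕂 n) (FreeAlgebra.cBasis 𝕂 n)
    ×
    -- φ : 𝒞 ⊗ Λ → 𝒩 is an isomorphism: it maps the basis
    -- { m_{w′}⋯m_{w⁽ʳ⁾} ⊗ 𝐦_μ } of 𝒞 ⊗ Λ onto a basis of 𝒩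
    FreeAlgebra.IsBasisOf 𝕂 n (FreeAlgebra.InN 𝕂 n)
      (λ p → FreeAlgebra.CIndex 𝕂 n (proj₁ p) × FreeAlgebra.LIndex 𝕂 n (proj₂ p))
      (FreeAlgebra.φBasis 𝕂 n)
theorem6p1 𝕂 _ n n≥1 = C-basis 𝕂 n n≥1 , φ-basis 𝕂 n n≥1
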